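{- Let $D=d_1,\dots,d_n$ and $F=f_1,\dots,f_n$ be tree degree sequences such that $\min(d_i,f_i)=1$ for all $i$. Let $T_1$ be a uniformly random tree realization of $D$ and $T_2$ an independent uniformly random tree realization of $F$ (both on the vertex set $\{v_1,\dots,v_n\}$). Then the expected number of common edges of $T_1$ and $T_2$ is $1$.
   Context: A degree sequence $D=d_1,\dots,d_n$ is a sequence of non-negative integers; a realization of $D$ is a simple graph on the labeled vertex set $\{v_1,\dots,v_n\}$ in which $v_i$ has degree exactly $d_i$. $D$ is a tree degree sequence if every $d_i$ is positive and $\sum_i d_i=2n-2$. A tree realization of $D$ is a realization that is a tree. -}

module Defs where

open import Data.Bool using (Bool; true; false; _∧_; _∨_; if_then_else_)
open import Data.Nat using (ℕ; zero; suc; _+_; _*_; _∸_; _≤_; _⊓_)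
import Data.Nat as ℕ
open import Data.Fin using (Fin; zero; suc; toℕ)
import Data.Fin.Properties as FinP
open import Data.List using (List; []; _∷_; length; map; concatMap; allFin; filterᵇ; zipWith)
open import Data.Nat.ListAction using (sum)
open import Data.Bool.ListAction using (and; or)
open import Data.Product using (_×_; _,_; proj₁; proj₂)
open import Relation.Nullary.Decidable using (⌊_⌋)

DegSeq : ℕ → Set
DegSeq n = Fin n → ℕ

-- D is a tree degree sequence: every d_i positive and Σ d_i = 2n - 2
-- (written Σ d_i + 2 = 2n to avoid truncated subtraction).
TreeDegSeq : (n : ℕ) → DegSeq n → Set
TreeDegSeq n d = ((i : Fin n) → 1 ≤ d i) × (sum (map d (allFin n)) + 2 ≡ 2 * n)
  where open import Relation.Binary.PropositionalEquality using (_≡_)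

pairs : (n : ℕ) → List (Fin n × Fin n)
pairs n = concatMap (λ i → map (λ j → (i , j)) (filterᵇ (λ j → ⌊ toℕ i ℕ.<? toℕ j ⌋) (allFin n))) (allFin n)

-- A simple graph on Fin n is given by an edge-indicator list, one Bool per pair.
record Graph (n : ℕ) : Set where
  constructor mkGraph
  field bits : List Bool
open Graph public

allBoolLists : ℕ → List (List Bool)
allBoolLists zero = [] ∷ []
allBoolLists (suc k) = concatMap (λ xs → (false ∷ xs) ∷ (true ∷ xs) ∷ []) (allBoolLists k)

allGraphs : (n : ℕ) → List (Graph n)
allGraphs n = map mkGraph (allBoolLists (length (pairs n)))

selectEdges : {A : Set} → List A → List Bool → List A
selectEdges [] _ = []
selectEdges (_ ∷ _) [] = []
selectEdges (p ∷ ps) (true ∷ bs) = p ∷ selectEdges ps bs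
selectEdges (p ∷ ps) (false ∷ bs) = selectEdges ps bs

edges : {n : ℕ} → Graph n → List (Fin n × Fin n)
edges {n} g = selectEdges (pairs n) (bits g)

_==_ : {n : ℕ} → Fin n → Fin n → Bool
i == j = ⌊ i FinP.≟ j ⌋

degree : {n : ℕ} → Graph n → Fin n → ℕ
degree g v = length (filterᵇ (λ e → (v == proj₁ e) ∨ (v == proj₂ e)) (edges g))

realizesᵇ : {n : ℕ} → DegSeq n → Graph n → Bool
realizesᵇ {n} d g = and (map (λ v → ⌊ degree g v ℕ.≟ d v ⌋) (allFin n))

step : {n : ℕ} → Graph n → (Fin n → Bool) → (Fin n → Bool)
step g r v = r v ∨ or (map (λ e → (r (proj₁ e) ∧ (v == proj₂ e)) ∨ (r (proj₂ e) ∧ (v == proj₁ e))) (edges g))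

iter : {A : Set} → ℕ → (A → A) → A → A
iter zero f x = x
iter (suc k) f x = f (iter k f x)

connectedᵇ : {n : ℕ} → Graph n → Bool
connectedᵇ {zero} g = true
connectedᵇ {suc m} g = and (map (iter (suc m) (step g) (λ v → v == zero)) (allFin (suc m)))

isTreeᵇ : {n : ℕ} → Graph n → Bool
isTreeᵇ {n} g = connectedᵇ g ∧ ⌊ length (edges g) ℕ.≟ n ∸ 1 ⌋

-- All tree realizations of d (the sample space of the uniform random tree).
treeRealizations : {n : ℕ} → DegSeq n → List (Graph n)
treeRealizations {n} d = filterᵇ (λ g → realizesᵇ d g ∧ isTreeᵇ g) (allGraphs n)

commonEdges : {n : ℕ} → Graph n → Graph n → ℕ
commonEdges g h = length (filterᵇ (λ b → b) (zipWith _∧_ (bits g) (bits h)))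

totalCommon : {n : ℕ} → DegSeq n → DegSeq n → ℕ
totalCommon d f = sum (concatMap (λ t₁ → map (λ t₂ → commonEdges t₁ t₂) (treeRealizations f)) (treeRealizations d))

-- Write t(d) for the number of tree realizations of d and a_i = d_i − 1. For n ≥ 3, removing a
-- leaf ℓ whose neighbour is k is a bijection between the realizations of d containing the edge ℓk
-- and the realizations of d with ℓ deleted and d_k lowered by one; by induction on n this gives
-- t(d) · ∏ a_i ! = (n − 2)!, and then, whenever i or j is a leaf, the number N_d(i,j) of
-- realizations containing the edge ij satisfies (n − 2) · N_d(i,j) = t(d) · (a_i + a_j).
-- The total number of common edges is Σ_{i<j} N_d(i,j) N_f(i,j). As every vertex is a leaf of d
-- or of f, in each pair either both formulas apply or both ends are leaves of one sequence and
-- the term vanishes on both sides; since a_i b_i = 0 (b = f − 1),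
-- (n − 2)² Σ_{i<j} N_d N_f = t(d) t(f) Σ_{i<j} (a_i + a_j)(b_i + b_j) = t(d) t(f) (Σ a)(Σ b),
-- and Σ a = Σ b = n − 2. Two vertices are checked by computation.

module Submission where

open import Data.Bool using (Bool; true; false; _∧_; _∨_; if_then_else_; T; T?)
import Data.Bool
open import Data.Bool.ListAction using (and; or)
open import Data.Bool.Properties using (∨-comm; ∨-zeroʳ; ∨-identityʳ; T-≡; ¬-not)
open import Data.Empty using (⊥; ⊥-elim)
open import Data.Fin using (Fin; zero; suc; toℕ; punchIn; punchOut)
import Data.Fin.Properties as Fin
open import Data.List using (List; []; _∷_; length; map; filterᵇ; allFin; tabulate; concatMap; _++_; zipWith)
open import Data.List.Membership.Propositional using (_∈_; _∉_)
open import Data.List.Membership.Propositional.Properties using (∈-allFin; ∈-map⁺; ∈-map⁻; ∈-filter⁺; ∈-filter⁻)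
open import Data.List.Membership.Propositional.Properties.WithK using (unique∧set⇒bag)
import Data.List.Properties as List
open import Data.List.Relation.Binary.BagAndSetEquality using (∼bag⇒↭; _∼[_]_; set)
open import Data.List.Relation.Binary.Permutation.Propositional.Properties using (↭-length)
open import Data.List.Relation.Unary.All using (All; []; _∷_)
import Data.List.Relation.Unary.All as All
import Data.List.Relation.Unary.All.Properties as All
open import Data.List.Relation.Unary.AllPairs using ([]; _∷_)
open import Data.List.Relation.Unary.Any using (here; there)
open import Data.List.Relation.Unary.Unique.Propositional using (Unique)
import Data.List.Relation.Unary.Unique.Propositional.Properties as Unique
open import Data.Nat using (ℕ; zero; suc; _+_; _*_; _∸_; _≤_; _⊓_; z≤n; s≤s; _!; >-nonZero)
import Data.Nat as ℕ
import Data.Nat.ListAction as ℕL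
import Data.Nat.ListAction.Properties as ℕL
open import Data.Nat.Properties
open import Algebra.Properties.CommutativeMonoid.Sum *-1-commutativeMonoid
  using () renaming (sum to product; sum-remove to product-remove; sum-cong-≗ to product-cong-≗)
open import Algebra.Properties.CommutativeSemigroup *-commutativeSemigroup
  using () renaming (interchange to *-interchange; x∙yz≈y∙xz to *-left-swap)
open import Algebra.Properties.Semiring.Sum +-*-semiring
  using (sum; sum-syntax; sum-cong-≗; ∑-distrib-+; ∑-comm; sum-remove; *-distribˡ-sum; *-distribʳ-sum)
open import Data.Product using (_×_; _,_; proj₁; proj₂; Σ-syntax; uncurry)
open import Data.Sum using (_⊎_; inj₁; inj₂)
open import Function using (_∘_; id)
open import Function.Bundles using (Equivalence; mk⇔)
open import Relation.Binary.Construct.Closure.ReflexiveTransitive using (Star; ε; _◅_; _◅◅_)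
import Relation.Binary.Construct.Closure.ReflexiveTransitive as Star
open import Relation.Binary.PropositionalEquality
open import Relation.Nullary using (¬_; Dec; yes; no; _×-dec_)
open import Relation.Nullary.Decidable using (⌊_⌋; toWitness; fromWitness)

open import Defs

𝟙 : Bool → ℕ
𝟙 true = 1
𝟙 false = 0

𝟙≤1 : (b : Bool) → 𝟙 b ≤ 1
𝟙≤1 true = ≤-refl
𝟙≤1 false = z≤n

𝟙-mono : {a b : Bool} → (a ≡ true → b ≡ true) → 𝟙 a ≤ 𝟙 b
𝟙-mono {false} _ = z≤n
𝟙-mono {true} a⇒b rewrite a⇒b refl = ≤-refl

𝟙-∧ : (x y : Bool) → 𝟙 (x ∧ y) ≡ 𝟙 x * 𝟙 y
𝟙-∧ true y = sym (+-identityʳ (𝟙 y))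
𝟙-∧ false y = refl

𝟙-∨ : (x y : Bool) → ¬ (x ≡ true × y ≡ true) → 𝟙 (x ∨ y) ≡ 𝟙 x + 𝟙 y
𝟙-∨ true true both = ⊥-elim (both (refl , refl))
𝟙-∨ true false _ = refl
𝟙-∨ false y _ = refl

𝟙≡0⇒ : {b : Bool} → 𝟙 b ≡ 0 → b ≡ false
𝟙≡0⇒ {false} _ = refl

true≢false : true ≢ false
true≢false ()

∨-elim : {x y : Bool} → (x ∨ y) ≡ true → x ≡ true ⊎ y ≡ true
∨-elim {true} _ = inj₁ refl
∨-elim {false} y = inj₂ y

∨-introʳ : (x : Bool) {y : Bool} → y ≡ true → (x ∨ y) ≡ true
∨-introʳ x refl = ∨-zeroʳ x

∧-elim : {x y : Bool} → (x ∧ y) ≡ true → x ≡ true × y ≡ true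
∧-elim {true} {true} _ = refl , refl

⌊⌋≡true⁺ : {P : Set} {p? : Dec P} → P → ⌊ p? ⌋ ≡ true
⌊⌋≡true⁺ p = Equivalence.to T-≡ (fromWitness p)

⌊⌋≡true⁻ : {P : Set} {p? : Dec P} → ⌊ p? ⌋ ≡ true → P
⌊⌋≡true⁻ p = toWitness (Equivalence.from T-≡ p)

==-refl : {n : ℕ} (i : Fin n) → (i == i) ≡ true
==-refl i with i Fin.≟ i
... | yes _ = refl
... | no i≢i = ⊥-elim (i≢i refl)

==-≢ : {n : ℕ} {i j : Fin n} → i ≢ j → (i == j) ≡ false
==-≢ {i = i} {j} i≢j with i Fin.≟ j
... | yes i≡j = ⊥-elim (i≢j i≡j)
... | no _ = refl

==⇒≡ : {n : ℕ} {i j : Fin n} → (i == j) ≡ true → i ≡ j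
==⇒≡ {i = i} {j} eq with i Fin.≟ j
... | yes i≡j = i≡j

==-sym : {n : ℕ} (i j : Fin n) → (i == j) ≡ (j == i)
==-sym i j with i Fin.≟ j | j Fin.≟ i
... | yes _ | yes _ = refl
... | no _ | no _ = refl
... | yes i≡j | no j≢i = ⊥-elim (j≢i (sym i≡j))
... | no i≢j | yes j≡i = ⊥-elim (i≢j (sym j≡i))

≢1⇒2≤ : {x : ℕ} → 1 ≤ x → x ≢ 1 → 2 ≤ x
≢1⇒2≤ {suc zero} _ x≢1 = ⊥-elim (x≢1 refl)
≢1⇒2≤ {suc (suc x)} _ _ = s≤s (s≤s z≤n)

⊓≡1⇒ : {a b : ℕ} → a ⊓ b ≡ 1 → a ≡ 1 ⊎ b ≡ 1
⊓≡1⇒ {a} {b} a⊓b with ⊓-sel a b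
... | inj₁ a⊓b≡a = inj₁ (trans (sym a⊓b≡a) a⊓b)
... | inj₂ a⊓b≡b = inj₂ (trans (sym a⊓b≡b) a⊓b)

∑-const : (n c : ℕ) → ∑[ i < n ] c ≡ n * c
∑-const zero c = refl
∑-const (suc n) c = cong (c +_) (∑-const n c)

∑-mono-≤ : {n : ℕ} {f g : Fin n → ℕ} → (∀ i → f i ≤ g i) → sum f ≤ sum g
∑-mono-≤ {zero} f≤g = z≤n
∑-mono-≤ {suc n} f≤g = +-mono-≤ (f≤g zero) (∑-mono-≤ (f≤g ∘ suc))

∑≡0⇒ : {n : ℕ} (f : Fin n → ℕ) → sum f ≡ 0 → ∀ i → f i ≡ 0
∑≡0⇒ f eq zero = m+n≡0⇒m≡0 (f zero) eq
∑≡0⇒ f eq (suc i) = ∑≡0⇒ (f ∘ suc) (m+n≡0⇒n≡0 (f zero) eq) i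

∑-zero : (n : ℕ) → ∑[ i < n ] 0 ≡ 0
∑-zero n = trans (∑-const n 0) (*-zeroʳ n)

∑-delta : {n : ℕ} (v : Fin n) (f : Fin n → ℕ) → ∑[ i < n ] (𝟙 (v == i) * f i) ≡ f v
∑-delta {suc n} v f = begin
    ∑[ i < suc n ] (𝟙 (v == i) * f i)
      ≡⟨ sum-remove {i = v} (λ i → 𝟙 (v == i) * f i) ⟩
    𝟙 (v == v) * f v + ∑[ i < n ] (𝟙 (v == punchIn v i) * f (punchIn v i))
      ≡⟨ cong₂ _+_ (cong (λ b → 𝟙 b * f v) (==-refl v)) (sum-cong-≗ off-diagonal) ⟩
    f v + 0 + ∑[ i < n ] 0
      ≡⟨ cong₂ _+_ (+-identityʳ (f v)) (∑-zero n) ⟩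
    f v + 0
      ≡⟨ +-identityʳ (f v) ⟩
    f v ∎
  where
  open ≡-Reasoning
  off-diagonal : ∀ i → 𝟙 (v == punchIn v i) * f (punchIn v i) ≡ 0
  off-diagonal i = cong (λ b → 𝟙 b * f (punchIn v i)) (==-≢ (Fin.punchInᵢ≢i v i ∘ sym))

∑-𝟙== : {n : ℕ} (v : Fin n) → ∑[ i < n ] 𝟙 (v == i) ≡ 1
∑-𝟙== v = trans (sum-cong-≗ (λ i → sym (*-identityʳ (𝟙 (v == i))))) (∑-delta v (λ _ → 1))

module _ {m : ℕ} where

  punchIn-view : (ℓ i : Fin (suc m)) → i ≡ ℓ ⊎ Σ[ a ∈ Fin m ] i ≡ punchIn ℓ a
  punchIn-view ℓ i with ℓ Fin.≟ i
  ... | yes ℓ≡i = inj₁ (sym ℓ≡i)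
  ... | no ℓ≢i = inj₂ (punchOut ℓ≢i , sym (Fin.punchIn-punchOut ℓ≢i))

  punchIn-elim : (ℓ : Fin (suc m)) (P : Fin (suc m) → Set) → P ℓ → (∀ a → P (punchIn ℓ a)) → ∀ i → P i
  punchIn-elim ℓ P pℓ pa i with punchIn-view ℓ i
  ... | inj₁ refl = pℓ
  ... | inj₂ (a , refl) = pa a

  punchOut-punchIn : (ℓ : Fin (suc m)) (a : Fin m) (ℓ≢ : ℓ ≢ punchIn ℓ a) → punchOut ℓ≢ ≡ a
  punchOut-punchIn ℓ a ℓ≢ = Fin.punchIn-injective ℓ _ _ (Fin.punchIn-punchOut ℓ≢)

  punchIn≢ : (ℓ : Fin (suc m)) (a : Fin m) → ℓ ≢ punchIn ℓ a
  punchIn≢ ℓ a = Fin.punchInᵢ≢i ℓ a ∘ sym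

∑-𝟙-unique : {m : ℕ} (f : Fin (suc m) → Bool) {k : Fin (suc m)} →
  ∑[ b < suc m ] 𝟙 (f b) ≡ 1 → f k ≡ true → ∀ b → f b ≡ (k == b)
∑-𝟙-unique {m} f {k} total fk b with punchIn-view k b
... | inj₁ refl = trans fk (sym (==-refl k))
... | inj₂ (c , refl) = trans (𝟙≡0⇒ (∑≡0⇒ (𝟙 ∘ f ∘ punchIn k) rest c)) (sym (==-≢ (punchIn≢ k c)))
  where
  rest : ∑[ c < m ] 𝟙 (f (punchIn k c)) ≡ 0
  rest = +-cancelˡ-≡ 1 _ _ (begin
      1 + ∑[ c < m ] 𝟙 (f (punchIn k c))        ≡⟨ cong (λ x → 𝟙 x + ∑[ c < m ] 𝟙 (f (punchIn k c))) (sym fk) ⟩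
      𝟙 (f k) + ∑[ c < m ] 𝟙 (f (punchIn k c))  ≡⟨ sym (sum-remove {i = k} (𝟙 ∘ f)) ⟩
      ∑[ b < suc m ] 𝟙 (f b)                    ≡⟨ total ⟩
      1                                         ∎)
    where open ≡-Reasoning

module _ {n : ℕ} where

  size : (Fin n → Bool) → ℕ
  size r = ∑[ v < n ] 𝟙 (r v)

  size≤ : (r : Fin n → Bool) → size r ≤ n
  size≤ r = subst (size r ≤_) (trans (∑-const n 1) (*-identityʳ n)) (∑-mono-≤ (𝟙≤1 ∘ r))

module _ {m : ℕ} where

  size-strict : {r r′ : Fin (suc m) → Bool} → (∀ {v} → r v ≡ true → r′ v ≡ true) →
    {w : Fin (suc m)} → r′ w ≡ true → r w ≡ false → suc (size r) ≤ size r′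
  size-strict {r} {r′} r⊆r′ {w} r′w rw = begin
      suc (size r)                          ≡⟨ cong suc (sum-remove {i = w} (𝟙 ∘ r)) ⟩
      suc (𝟙 (r w) + size (r ∘ punchIn w))  ≡⟨ cong (λ b → suc (𝟙 b + size (r ∘ punchIn w))) rw ⟩
      suc (size (r ∘ punchIn w))            ≤⟨ s≤s (∑-mono-≤ {f = 𝟙 ∘ r ∘ punchIn w} (λ i → 𝟙-mono r⊆r′)) ⟩
      suc (size (r′ ∘ punchIn w))           ≡⟨ cong (λ b → 𝟙 b + size (r′ ∘ punchIn w)) (sym r′w) ⟩
      𝟙 (r′ w) + size (r′ ∘ punchIn w)      ≡⟨ sym (sum-remove {i = w} (𝟙 ∘ r′)) ⟩
      size r′                               ∎
    where open ≤-Reasoning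

  size-full : (r : Fin (suc m) → Bool) → suc m ≤ size r → ∀ v → r v ≡ true
  size-full r n≤ v with r v in rv
  ... | true = refl
  ... | false = ⊥-elim (<-irrefl refl (≤-trans n≤ (subst (_≤ _) (sym size-r) (size≤ (r ∘ punchIn v)))))
    where
    size-r : size r ≡ size (r ∘ punchIn v)
    size-r = trans (sum-remove {i = v} (𝟙 ∘ r)) (cong (λ b → 𝟙 b + size (r ∘ punchIn v)) rv)

_<ᵇ_ : {n : ℕ} → Fin n → Fin n → Bool
i <ᵇ j = ⌊ toℕ i ℕ.<? toℕ j ⌋

<ᵇ-irrefl : {n : ℕ} (i : Fin n) → (i <ᵇ i) ≡ false
<ᵇ-irrefl i with toℕ i ℕ.<? toℕ i
... | yes i<i = ⊥-elim (<-irrefl refl i<i)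
... | no _ = refl

<ᵇ-asym : {n : ℕ} {i j : Fin n} → (i <ᵇ j) ≡ true → (j <ᵇ i) ≡ false
<ᵇ-asym {i = i} {j} i<j with toℕ i ℕ.<? toℕ j | toℕ j ℕ.<? toℕ i
... | yes p | yes q = ⊥-elim (<-asym p q)
... | _ | no _ = refl

<ᵇ⇒≢ : {n : ℕ} {i j : Fin n} → (i <ᵇ j) ≡ true → i ≢ j
<ᵇ⇒≢ {i = i} i<j refl = true≢false (trans (sym i<j) (<ᵇ-irrefl i))

≮ᵇ⇒>ᵇ : {n : ℕ} {i j : Fin n} → i ≢ j → (i <ᵇ j) ≡ false → (j <ᵇ i) ≡ true
≮ᵇ⇒>ᵇ {i = i} {j} i≢j i≮j with toℕ i ℕ.<? toℕ j | toℕ j ℕ.<? toℕ i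
... | _ | yes _ = refl
... | no p | no q = ⊥-elim (i≢j (Fin.toℕ-injective (≤-antisym (≮⇒≥ q) (≮⇒≥ p))))

∑-pairs-disjoint-supports : {n : ℕ} (a b : Fin n → ℕ) → (∀ i → a i * b i ≡ 0) →
  ∑[ i < n ] ∑[ j < n ] (𝟙 (i <ᵇ j) * ((a i + a j) * (b i + b j))) ≡ sum a * sum b
∑-pairs-disjoint-supports {n} a b disjoint = begin
    ∑[ i < n ] ∑[ j < n ] (𝟙 (i <ᵇ j) * ((a i + a j) * (b i + b j)))
      ≡⟨ sum-cong-≗ (λ i → sum-cong-≗ (λ j → cong (𝟙 (i <ᵇ j) *_) (cross-terms i j))) ⟩
    ∑[ i < n ] ∑[ j < n ] (𝟙 (i <ᵇ j) * (a i * b j + a j * b i))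
      ≡⟨ sum-cong-≗ (λ i → trans (sum-cong-≗ (λ j → *-distribˡ-+ (𝟙 (i <ᵇ j)) (a i * b j) (a j * b i)))
                                 (∑-distrib-+ (P i) (Q i))) ⟩
    ∑[ i < n ] (∑[ j < n ] (𝟙 (i <ᵇ j) * (a i * b j)) + ∑[ j < n ] (𝟙 (i <ᵇ j) * (a j * b i)))
      ≡⟨ ∑-distrib-+ (sum ∘ P) (sum ∘ Q) ⟩
    ∑[ i < n ] ∑[ j < n ] (𝟙 (i <ᵇ j) * (a i * b j)) + ∑[ i < n ] ∑[ j < n ] (𝟙 (i <ᵇ j) * (a j * b i))
      ≡⟨ cong (∑[ i < n ] ∑[ j < n ] (𝟙 (i <ᵇ j) * (a i * b j)) +_) (∑-comm (λ i j → 𝟙 (i <ᵇ j) * (a j * b i))) ⟩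
    ∑[ i < n ] ∑[ j < n ] (𝟙 (i <ᵇ j) * (a i * b j)) + ∑[ i < n ] ∑[ j < n ] (𝟙 (j <ᵇ i) * (a i * b j))
      ≡⟨ sym (trans (sum-cong-≗ (λ i → ∑-distrib-+ (P i) (λ j → Q j i))) (∑-distrib-+ (sum ∘ P) (λ i → ∑[ j < n ] Q j i))) ⟩
    ∑[ i < n ] ∑[ j < n ] (𝟙 (i <ᵇ j) * (a i * b j) + 𝟙 (j <ᵇ i) * (a i * b j))
      ≡⟨ sum-cong-≗ (λ i → sum-cong-≗ (λ j → trans (sym (*-distribʳ-+ (a i * b j) (𝟙 (i <ᵇ j)) (𝟙 (j <ᵇ i))))
                                                   (exactly-one-order i j))) ⟩
    ∑[ i < n ] ∑[ j < n ] (a i * b j)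
      ≡⟨ sum-cong-≗ (λ i → sym (*-distribˡ-sum (a i) b)) ⟩
    ∑[ i < n ] (a i * sum b)
      ≡⟨ sym (*-distribʳ-sum (sum b) a) ⟩
    sum a * sum b ∎
  where
  open ≡-Reasoning
  P Q : Fin n → Fin n → ℕ
  P i j = 𝟙 (i <ᵇ j) * (a i * b j)
  Q i j = 𝟙 (i <ᵇ j) * (a j * b i)
  cross-terms : ∀ i j → (a i + a j) * (b i + b j) ≡ a i * b j + a j * b i
  cross-terms i j = begin
      (a i + a j) * (b i + b j)
        ≡⟨ *-distribʳ-+ (b i + b j) (a i) (a j) ⟩
      a i * (b i + b j) + a j * (b i + b j)
        ≡⟨ cong₂ _+_ (*-distribˡ-+ (a i) (b i) (b j)) (*-distribˡ-+ (a j) (b i) (b j)) ⟩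
      (a i * b i + a i * b j) + (a j * b i + a j * b j)
        ≡⟨ cong₂ (λ x y → (x + a i * b j) + (a j * b i + y)) (disjoint i) (disjoint j) ⟩
      a i * b j + (a j * b i + 0)
        ≡⟨ cong (a i * b j +_) (+-identityʳ (a j * b i)) ⟩
      a i * b j + a j * b i ∎
  exactly-one-order : ∀ i j → (𝟙 (i <ᵇ j) + 𝟙 (j <ᵇ i)) * (a i * b j) ≡ a i * b j
  exactly-one-order i j with i Fin.≟ j
  ... | yes refl rewrite <ᵇ-irrefl i = sym (disjoint i)
  ... | no i≢j with i <ᵇ j in i<j
  ...   | true rewrite <ᵇ-asym i<j = +-identityʳ (a i * b j)
  ...   | false rewrite ≮ᵇ⇒>ᵇ i≢j i<j = +-identityʳ (a i * b j)

∑ˡ : {A : Set} → (A → ℕ) → List A → ℕ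
∑ˡ f xs = ℕL.sum (map f xs)

module _ {A : Set} where

  ∑ˡ-++ : (f : A → ℕ) (xs ys : List A) → ∑ˡ f (xs ++ ys) ≡ ∑ˡ f xs + ∑ˡ f ys
  ∑ˡ-++ f xs ys = trans (cong ℕL.sum (List.map-++ f xs ys)) (ℕL.sum-++ (map f xs) (map f ys))

  ∑ˡ-cong : {f g : A → ℕ} (xs : List A) → (∀ x → x ∈ xs → f x ≡ g x) → ∑ˡ f xs ≡ ∑ˡ g xs
  ∑ˡ-cong [] eq = refl
  ∑ˡ-cong (x ∷ xs) eq = cong₂ _+_ (eq x (here refl)) (∑ˡ-cong xs (λ y y∈xs → eq y (there y∈xs)))

  ∑ˡ-*ˡ : (c : ℕ) (f : A → ℕ) (xs : List A) → ∑ˡ (λ x → c * f x) xs ≡ c * ∑ˡ f xs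
  ∑ˡ-*ˡ c f [] = sym (*-zeroʳ c)
  ∑ˡ-*ˡ c f (x ∷ xs) = trans (cong (c * f x +_) (∑ˡ-*ˡ c f xs)) (sym (*-distribˡ-+ c (f x) _))

  ∑ˡ-*ʳ : (c : ℕ) (f : A → ℕ) (xs : List A) → ∑ˡ (λ x → f x * c) xs ≡ ∑ˡ f xs * c
  ∑ˡ-*ʳ c f xs = trans (∑ˡ-cong xs (λ x _ → *-comm (f x) c)) (trans (∑ˡ-*ˡ c f xs) (*-comm c _))

  ∑ˡ-filterᵇ : (f : A → ℕ) (p : A → Bool) (xs : List A) → ∑ˡ f (filterᵇ p xs) ≡ ∑ˡ (λ x → 𝟙 (p x) * f x) xs
  ∑ˡ-filterᵇ f p [] = refl
  ∑ˡ-filterᵇ f p (x ∷ xs) with p x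
  ... | true = cong₂ _+_ (sym (+-identityʳ (f x))) (∑ˡ-filterᵇ f p xs)
  ... | false = ∑ˡ-filterᵇ f p xs

  length-filterᵇ : (p : A → Bool) (xs : List A) → length (filterᵇ p xs) ≡ ∑ˡ (𝟙 ∘ p) xs
  length-filterᵇ p [] = refl
  length-filterᵇ p (x ∷ xs) with p x
  ... | true = cong suc (length-filterᵇ p xs)
  ... | false = length-filterᵇ p xs

  ∈-filterᵇ⁺ : (p : A → Bool) {x : A} {xs : List A} → x ∈ xs → p x ≡ true → x ∈ filterᵇ p xs
  ∈-filterᵇ⁺ p x∈ px = ∈-filter⁺ (T? ∘ p) x∈ (Equivalence.from T-≡ px)

  ∈-filterᵇ⁻ : (p : A → Bool) {x : A} {xs : List A} → x ∈ filterᵇ p xs → x ∈ xs × p x ≡ true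
  ∈-filterᵇ⁻ p x∈ with x∈xs , px ← ∈-filter⁻ (T? ∘ p) x∈ = x∈xs , Equivalence.to T-≡ px

  unique-filterᵇ : (p : A → Bool) {xs : List A} → Unique xs → Unique (filterᵇ p xs)
  unique-filterᵇ p = Unique.filter⁺ (T? ∘ p)

  ∑ˡ-const : (c : ℕ) (xs : List A) → ∑ˡ (λ _ → c) xs ≡ c * length xs
  ∑ˡ-const c [] = sym (*-zeroʳ c)
  ∑ˡ-const c (_ ∷ xs) = trans (cong (c +_) (∑ˡ-const c xs)) (sym (*-suc c (length xs)))

  ∑ˡ-∑ : {n : ℕ} (f : A → Fin n → ℕ) (xs : List A) → ∑ˡ (λ x → ∑[ i < n ] f x i) xs ≡ ∑[ i < n ] ∑ˡ (λ x → f x i) xs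
  ∑ˡ-∑ {n} f [] = sym (∑-zero n)
  ∑ˡ-∑ f (x ∷ xs) = trans (cong (sum (f x) +_) (∑ˡ-∑ f xs)) (sym (∑-distrib-+ (f x) _))

  length-by-classes : {n : ℕ} (P : A → Fin n → Bool) (xs : List A) → (∀ {x} → x ∈ xs → ∑[ k < n ] 𝟙 (P x k) ≡ 1) →
    length xs ≡ ∑[ k < n ] length (filterᵇ (λ x → P x k) xs)
  length-by-classes {n} P xs one-class = begin
      length xs                                     ≡⟨ sym (trans (∑ˡ-const 1 xs) (*-identityˡ (length xs))) ⟩
      ∑ˡ (λ _ → 1) xs                               ≡⟨ ∑ˡ-cong xs (λ x x∈ → sym (one-class x∈)) ⟩
      ∑ˡ (λ x → ∑[ k < n ] 𝟙 (P x k)) xs            ≡⟨ ∑ˡ-∑ (λ x k → 𝟙 (P x k)) xs ⟩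
      ∑[ k < n ] ∑ˡ (λ x → 𝟙 (P x k)) xs            ≡⟨ sum-cong-≗ (λ k → sym (length-filterᵇ (λ x → P x k) xs)) ⟩
      ∑[ k < n ] length (filterᵇ (λ x → P x k) xs)  ∎
    where open ≡-Reasoning

module _ {A B : Set} where

  ∑ˡ-map : (f : B → ℕ) (g : A → B) (xs : List A) → ∑ˡ f (map g xs) ≡ ∑ˡ (f ∘ g) xs
  ∑ˡ-map f g xs = cong ℕL.sum (sym (List.map-∘ xs))

  ∑ˡ-concatMap : (f : B → ℕ) (g : A → List B) (xs : List A) → ∑ˡ f (concatMap g xs) ≡ ∑ˡ (∑ˡ f ∘ g) xs
  ∑ˡ-concatMap f g [] = refl
  ∑ˡ-concatMap f g (x ∷ xs) = trans (∑ˡ-++ f (g x) (concatMap g xs)) (cong (∑ˡ f (g x) +_) (∑ˡ-concatMap f g xs))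

∑ˡ-allFin : {n : ℕ} (f : Fin n → ℕ) → ∑ˡ f (allFin n) ≡ sum f
∑ˡ-allFin {zero} f = refl
∑ˡ-allFin {suc n} f = cong (f zero +_) (trans (cong ℕL.sum tabulate-shift) (∑ˡ-allFin (f ∘ suc)))
  where
  tabulate-shift : map f (tabulate (suc {n})) ≡ map (f ∘ suc) (allFin n)
  tabulate-shift = trans (List.map-tabulate suc f) (sym (List.map-tabulate id (f ∘ suc)))

length-∅ : {A : Set} (xs : List A) → (∀ {x} → x ∉ xs) → length xs ≡ 0
length-∅ [] _ = refl
length-∅ (x ∷ xs) ∉xs = ⊥-elim (∉xs (here refl))

zipWith-∧-map : {A : Set} (p q : A → Bool) (xs : List A) → zipWith _∧_ (map p xs) (map q xs) ≡ map (λ x → p x ∧ q x) xs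
zipWith-∧-map p q [] = refl
zipWith-∧-map p q (x ∷ xs) = cong (p x ∧ q x ∷_) (zipWith-∧-map p q xs)

module _ {A : Set} (f : A → Bool) where

  and-map⁻ : {xs : List A} → and (map f xs) ≡ true → ∀ {x} → x ∈ xs → f x ≡ true
  and-map⁻ {xs} all-true x∈ = Equivalence.to T-≡ (All.lookup (All.all⁺ f xs (Equivalence.from T-≡ all-true)) x∈)

  and-map⁺ : {xs : List A} → (∀ {x} → x ∈ xs → f x ≡ true) → and (map f xs) ≡ true
  and-map⁺ all-true = Equivalence.to T-≡ (All.all⁻ f (All.tabulate (Equivalence.from T-≡ ∘ all-true)))

  or-map⁻ : {xs : List A} → or (map f xs) ≡ true → Σ[ x ∈ A ] x ∈ xs × f x ≡ true
  or-map⁻ {x ∷ xs} some-true with f x in fx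
  ... | true = x , here refl , fx
  ... | false with y , y∈ , fy ← or-map⁻ some-true = y , there y∈ , fy

  or-map⁺ : {xs : List A} {x : A} → x ∈ xs → f x ≡ true → or (map f xs) ≡ true
  or-map⁺ {y ∷ xs} (here refl) fx rewrite fx = refl
  or-map⁺ {y ∷ xs} (there x∈) fx rewrite or-map⁺ x∈ fx = ∨-zeroʳ (f y)

module _ {A B : Set} {xs : List A} {ys : List B} where

  length-≡-by-bijection : Unique xs → Unique ys → (f : A → B) (g : B → A) →
    (∀ {x} → x ∈ xs → f x ∈ ys) → (∀ {y} → y ∈ ys → g y ∈ xs) →
    (∀ {x} → x ∈ xs → g (f x) ≡ x) → (∀ {y} → y ∈ ys → f (g y) ≡ y) →
    length xs ≡ length ys
  length-≡-by-bijection xs! ys! f g f∈ g∈ gf fg =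
    trans (sym (List.length-map f xs)) (↭-length (∼bag⇒↭ (unique∧set⇒bag fxs! ys! same-elements)))
    where
    gfxs≡xs : map g (map f xs) ≡ xs
    gfxs≡xs = trans (sym (List.map-∘ xs)) (trans (List.map-cong-local (All.tabulate gf)) (List.map-id xs))
    fxs! : Unique (map f xs)
    fxs! = Unique.map⁻ (subst Unique (sym gfxs≡xs) xs!)
    same-elements : map f xs ∼[ set ] ys
    same-elements {y} = mk⇔ to from
      where
      to : y ∈ map f xs → y ∈ ys
      to y∈ with x , x∈xs , refl ← ∈-map⁻ f y∈ = f∈ x∈xs
      from : y ∈ ys → y ∈ map f xs
      from y∈ys = subst (_∈ map f xs) (fg y∈ys) (∈-map⁺ f (g∈ y∈ys))

consBoth : List Bool → List (List Bool)
consBoth xs = (false ∷ xs) ∷ (true ∷ xs) ∷ []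

∈-consBoth⁻ : {z : List Bool} (ys : List (List Bool)) → z ∈ concatMap consBoth ys →
  Σ[ y ∈ List Bool ] y ∈ ys × Σ[ b ∈ Bool ] z ≡ b ∷ y
∈-consBoth⁻ (y ∷ ys) (here eq) = y , here refl , false , eq
∈-consBoth⁻ (y ∷ ys) (there (here eq)) = y , here refl , true , eq
∈-consBoth⁻ (y ∷ ys) (there (there z∈)) with w , w∈ , b , eq ← ∈-consBoth⁻ ys z∈ = w , there w∈ , b , eq

∈-consBoth⁺ : (b : Bool) {y : List Bool} (ys : List (List Bool)) → y ∈ ys → (b ∷ y) ∈ concatMap consBoth ys
∈-consBoth⁺ false (y ∷ ys) (here refl) = here refl
∈-consBoth⁺ true (y ∷ ys) (here refl) = there (here refl)
∈-consBoth⁺ b (y ∷ ys) (there y∈) = there (there (∈-consBoth⁺ b ys y∈))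

length-∈-allBoolLists : (k : ℕ) {xs : List Bool} → xs ∈ allBoolLists k → length xs ≡ k
length-∈-allBoolLists zero (here refl) = refl
length-∈-allBoolLists (suc k) xs∈ with _ , y∈ , _ , refl ← ∈-consBoth⁻ (allBoolLists k) xs∈ =
  cong suc (length-∈-allBoolLists k y∈)

∈-allBoolLists : (xs : List Bool) → xs ∈ allBoolLists (length xs)
∈-allBoolLists [] = here refl
∈-allBoolLists (b ∷ xs) = ∈-consBoth⁺ b (allBoolLists (length xs)) (∈-allBoolLists xs)

allBoolLists-unique : (k : ℕ) → Unique (allBoolLists k)
allBoolLists-unique zero = [] ∷ []
allBoolLists-unique (suc k) = unique-concatMap (allBoolLists k) (allBoolLists-unique k)
  where
  ∉-tail : {y : List Bool} {ys : List (List Bool)} → All (y ≢_) ys → (b : Bool) → All (b ∷ y ≢_) (concatMap consBoth ys)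
  ∉-tail {y} {ys} y∉ b = All.tabulate fresh
    where
    fresh : ∀ {z} → z ∈ concatMap consBoth ys → b ∷ y ≢ z
    fresh z∈ eq with w , w∈ , _ , refl ← ∈-consBoth⁻ ys z∈ = All.lookup y∉ w∈ (List.∷-injectiveʳ eq)
  unique-concatMap : (ys : List (List Bool)) → Unique ys → Unique (concatMap consBoth ys)
  unique-concatMap [] _ = []
  unique-concatMap (y ∷ ys) (y∉ ∷ ys!) = ((λ ()) ∷ ∉-tail y∉ false) ∷ ∉-tail y∉ true ∷ unique-concatMap ys ys!

allGraphs-unique : (n : ℕ) → Unique (allGraphs n)
allGraphs-unique n = Unique.map⁺ (cong bits) (allBoolLists-unique (length (pairs n)))

∈-allGraphs⁻ : {n : ℕ} {g : Graph n} → g ∈ allGraphs n → length (bits g) ≡ length (pairs n)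
∈-allGraphs⁻ {n} g∈ with _ , xs∈ , refl ← ∈-map⁻ mkGraph g∈ = length-∈-allBoolLists (length (pairs n)) xs∈

∈-allGraphs⁺ : {n : ℕ} (g : Graph n) → length (bits g) ≡ length (pairs n) → g ∈ allGraphs n
∈-allGraphs⁺ {n} (mkGraph xs) eq = ∈-map⁺ mkGraph (subst (λ k → xs ∈ allBoolLists k) eq (∈-allBoolLists xs))

∑-pairs : {n : ℕ} (f : Fin n × Fin n → ℕ) →
  ∑ˡ f (pairs n) ≡ ∑[ i < n ] ∑[ j < n ] (𝟙 (i <ᵇ j) * f (i , j))
∑-pairs {n} f = begin
    ∑ˡ f (pairs n)
      ≡⟨ ∑ˡ-concatMap f row (allFin n) ⟩
    ∑ˡ (∑ˡ f ∘ row) (allFin n)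
      ≡⟨ ∑ˡ-allFin (∑ˡ f ∘ row) ⟩
    ∑[ i < n ] ∑ˡ f (row i)
      ≡⟨ sum-cong-≗ row-sum ⟩
    ∑[ i < n ] ∑[ j < n ] (𝟙 (i <ᵇ j) * f (i , j)) ∎
  where
  open ≡-Reasoning
  row : Fin n → List (Fin n × Fin n)
  row i = map (i ,_) (filterᵇ (i <ᵇ_) (allFin n))
  row-sum : ∀ i → ∑ˡ f (row i) ≡ ∑[ j < n ] (𝟙 (i <ᵇ j) * f (i , j))
  row-sum i = trans (∑ˡ-map f (i ,_) (filterᵇ (i <ᵇ_) (allFin n)))
    (trans (∑ˡ-filterᵇ (λ j → f (i , j)) (i <ᵇ_) (allFin n)) (∑ˡ-allFin (λ j → 𝟙 (i <ᵇ j) * f (i , j))))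

_==²_ : {n : ℕ} → Fin n × Fin n → Fin n × Fin n → Bool
(a , b) ==² (i , j) = (a == i) ∧ (b == j)

==²-refl : {n : ℕ} (p : Fin n × Fin n) → (p ==² p) ≡ true
==²-refl (a , b) rewrite ==-refl a | ==-refl b = refl

==²⇒≡ : {n : ℕ} {p q : Fin n × Fin n} → (p ==² q) ≡ true → p ≡ q
==²⇒≡ {p = a , b} {i , j} eq with a == i in a=i | b == j in b=j
... | true | true = cong₂ _,_ (==⇒≡ a=i) (==⇒≡ b=j)

multiplicity : {n : ℕ} → Fin n × Fin n → List (Fin n × Fin n) → ℕ
multiplicity q = ∑ˡ (λ p → 𝟙 (q ==² p))

multiplicity-pairs : {n : ℕ} (a b : Fin n) → multiplicity (a , b) (pairs n) ≡ 𝟙 (a <ᵇ b)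
multiplicity-pairs {n} a b = begin
    multiplicity (a , b) (pairs n)
      ≡⟨ ∑-pairs (λ p → 𝟙 ((a , b) ==² p)) ⟩
    ∑[ i < n ] ∑[ j < n ] (𝟙 (i <ᵇ j) * 𝟙 ((a == i) ∧ (b == j)))
      ≡⟨ sum-cong-≗ (λ i → sum-cong-≗ (λ j → rearrange i j)) ⟩
    ∑[ i < n ] ∑[ j < n ] (𝟙 (a == i) * (𝟙 (b == j) * 𝟙 (i <ᵇ j)))
      ≡⟨ sum-cong-≗ (λ i → sym (*-distribˡ-sum (𝟙 (a == i)) (λ j → 𝟙 (b == j) * 𝟙 (i <ᵇ j)))) ⟩
    ∑[ i < n ] (𝟙 (a == i) * ∑[ j < n ] (𝟙 (b == j) * 𝟙 (i <ᵇ j)))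
      ≡⟨ ∑-delta a _ ⟩
    ∑[ j < n ] (𝟙 (b == j) * 𝟙 (a <ᵇ j))
      ≡⟨ ∑-delta b _ ⟩
    𝟙 (a <ᵇ b) ∎
  where
  open ≡-Reasoning
  rearrange : ∀ i j → 𝟙 (i <ᵇ j) * 𝟙 ((a == i) ∧ (b == j)) ≡ 𝟙 (a == i) * (𝟙 (b == j) * 𝟙 (i <ᵇ j))
  rearrange i j rewrite 𝟙-∧ (a == i) (b == j) = trans (*-comm (𝟙 (i <ᵇ j)) _) (*-assoc (𝟙 (a == i)) _ _)

module _ {n : ℕ} where

  ∈⇒1≤multiplicity : {q : Fin n × Fin n} (xs : List (Fin n × Fin n)) → q ∈ xs → 1 ≤ multiplicity q xs
  ∈⇒1≤multiplicity {q} (_ ∷ xs) (here refl) rewrite ==²-refl q = s≤s z≤n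
  ∈⇒1≤multiplicity (x ∷ xs) (there q∈) = ≤-trans (∈⇒1≤multiplicity xs q∈) (m≤n+m _ _)

  1≤multiplicity⇒∈ : {q : Fin n × Fin n} (xs : List (Fin n × Fin n)) → 1 ≤ multiplicity q xs → q ∈ xs
  1≤multiplicity⇒∈ {q} (x ∷ xs) 1≤ with q ==² x in q=x
  ... | true = here (==²⇒≡ q=x)
  ... | false = there (1≤multiplicity⇒∈ xs 1≤)

  multiplicity≤1⇒unique : (xs : List (Fin n × Fin n)) → (∀ q → multiplicity q xs ≤ 1) → Unique xs
  multiplicity≤1⇒unique [] _ = []
  multiplicity≤1⇒unique (x ∷ xs) ≤1 =
    All.tabulate x∉xs ∷ multiplicity≤1⇒unique xs (λ q → ≤-trans (m≤n+m _ _) (≤1 q))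
    where
    x∉xs : ∀ {z} → z ∈ xs → x ≢ z
    x∉xs z∈ refl with ≤1 x
    ... | ≤1x rewrite ==²-refl x = <-irrefl refl (≤-trans (s≤s (∈⇒1≤multiplicity xs z∈)) ≤1x)

pairs-unique : (n : ℕ) → Unique (pairs n)
pairs-unique n = multiplicity≤1⇒unique (pairs n)
  (λ (a , b) → subst (_≤ 1) (sym (multiplicity-pairs a b)) (𝟙≤1 (a <ᵇ b)))

∈-pairs⁺ : {n : ℕ} {a b : Fin n} → (a <ᵇ b) ≡ true → (a , b) ∈ pairs n
∈-pairs⁺ {a = a} {b} a<b = 1≤multiplicity⇒∈ _ (subst (1 ≤_) (sym (trans (multiplicity-pairs a b) (cong 𝟙 a<b))) ≤-refl)

∈-pairs⁻ : {n : ℕ} {a b : Fin n} → (a , b) ∈ pairs n → (a <ᵇ b) ≡ true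
∈-pairs⁻ {a = a} {b} ab∈ with a <ᵇ b in a<b
... | true = refl
... | false = ⊥-elim (<-irrefl refl (subst (1 ≤_) (trans (multiplicity-pairs a b) (cong 𝟙 a<b)) (∈⇒1≤multiplicity _ ab∈)))

module _ {n : ℕ} where

  bitAt : List (Fin n × Fin n) → List Bool → Fin n → Fin n → Bool
  bitAt [] _ i j = false
  bitAt (_ ∷ _) [] i j = false
  bitAt (p ∷ ps) (x ∷ bs) i j = if p ==² (i , j) then x else bitAt ps bs i j

  bitAt-map-∈ : (h : Fin n × Fin n → Bool) (ps : List (Fin n × Fin n)) {i j : Fin n} →
    (i , j) ∈ ps → bitAt ps (map h ps) i j ≡ h (i , j)
  bitAt-map-∈ h (p ∷ ps) {i} {j} ij∈ with p ==² (i , j) in p=ij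
  ... | true = cong h (==²⇒≡ p=ij)
  bitAt-map-∈ h (p ∷ ps) (here refl) | false = ⊥-elim (true≢false (trans (sym (==²-refl p)) p=ij))
  bitAt-map-∈ h (p ∷ ps) (there ij∈) | false = bitAt-map-∈ h ps ij∈

  bitAt-map-∉ : (h : Fin n × Fin n → Bool) (ps : List (Fin n × Fin n)) {i j : Fin n} →
    (i , j) ∉ ps → bitAt ps (map h ps) i j ≡ false
  bitAt-map-∉ h [] _ = refl
  bitAt-map-∉ h (p ∷ ps) {i} {j} ij∉ with p ==² (i , j) in p=ij
  ... | true = ⊥-elim (ij∉ (here (sym (==²⇒≡ p=ij))))
  ... | false = bitAt-map-∉ h ps (ij∉ ∘ there)

  bits-reconstruct : (ps : List (Fin n × Fin n)) (bs : List Bool) → Unique ps → length bs ≡ length ps →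
    bs ≡ map (λ (i , j) → bitAt ps bs i j) ps
  bits-reconstruct [] [] _ _ = refl
  bits-reconstruct (p ∷ ps) (x ∷ bs) (p∉ps ∷ ps!) eq rewrite ==²-refl p =
    cong (x ∷_) (trans (bits-reconstruct ps bs ps! (suc-injective eq)) (List.map-cong-local (All.tabulate skip)))
    where
    skip : ∀ {q} → q ∈ ps → bitAt ps bs (proj₁ q) (proj₂ q) ≡ bitAt (p ∷ ps) (x ∷ bs) (proj₁ q) (proj₂ q)
    skip {q} q∈ with p ==² q in p=q
    ... | true = ⊥-elim (All.lookup p∉ps q∈ (==²⇒≡ p=q))
    ... | false = refl

  edgeBit : Graph n → Fin n → Fin n → Bool
  edgeBit g = bitAt (pairs n) (bits g)

  adjacent : Graph n → Fin n → Fin n → Bool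
  adjacent g i j = edgeBit g i j ∨ edgeBit g j i

  graphOf : (Fin n → Fin n → Bool) → Graph n
  graphOf h = mkGraph (map (λ (i , j) → h i j) (pairs n))

  graphOf-∈-allGraphs : (h : Fin n → Fin n → Bool) → graphOf h ∈ allGraphs n
  graphOf-∈-allGraphs h = ∈-allGraphs⁺ (graphOf h) (List.length-map _ (pairs n))

  graphOf-edgeBit : {g : Graph n} → g ∈ allGraphs n → g ≡ graphOf (edgeBit g)
  graphOf-edgeBit {mkGraph bs} g∈ = cong mkGraph (bits-reconstruct (pairs n) bs (pairs-unique n) (∈-allGraphs⁻ g∈))

  graphOf-cong : {h h′ : Fin n → Fin n → Bool} → (∀ {i j} → (i <ᵇ j) ≡ true → h i j ≡ h′ i j) → graphOf h ≡ graphOf h′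
  graphOf-cong eq = cong mkGraph (List.map-cong-local (All.tabulate (λ ij∈ → eq (∈-pairs⁻ ij∈))))

  edgeBit-graphOf : (h : Fin n → Fin n → Bool) (i j : Fin n) → edgeBit (graphOf h) i j ≡ (i <ᵇ j) ∧ h i j
  edgeBit-graphOf h i j with i <ᵇ j in i<j
  ... | true = bitAt-map-∈ (λ (i , j) → h i j) (pairs n) (∈-pairs⁺ i<j)
  ... | false = bitAt-map-∉ (λ (i , j) → h i j) (pairs n) (λ ij∈ → true≢false (trans (sym (∈-pairs⁻ ij∈)) i<j))

module _ {A : Set} where

  selectEdges-⊆ : {x : A} (ps : List A) (bs : List Bool) → x ∈ selectEdges ps bs → x ∈ ps
  selectEdges-⊆ (p ∷ ps) (true ∷ bs) (here refl) = here refl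
  selectEdges-⊆ (p ∷ ps) (true ∷ bs) (there x∈) = there (selectEdges-⊆ ps bs x∈)
  selectEdges-⊆ (p ∷ ps) (false ∷ bs) x∈ = there (selectEdges-⊆ ps bs x∈)

  selectEdges-map : (h : A → Bool) (ps : List A) → selectEdges ps (map h ps) ≡ filterᵇ h ps
  selectEdges-map h [] = refl
  selectEdges-map h (p ∷ ps) with h p
  ... | true = cong (p ∷_) (selectEdges-map h ps)
  ... | false = selectEdges-map h ps

module _ {n : ℕ} where

  incident : Fin n → Fin n × Fin n → Bool
  incident v (i , j) = (v == i) ∨ (v == j)

  ends : Fin n → Fin n × Fin n → ℕ
  ends v (i , j) = 𝟙 (v == i) + 𝟙 (v == j)

  Loopless : List (Fin n × Fin n) → Set
  Loopless es = ∀ {i j} → (i , j) ∈ es → i ≢ j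

  edges-loopless : (g : Graph n) → Loopless (edges g)
  edges-loopless g ij∈ = <ᵇ⇒≢ (∈-pairs⁻ (selectEdges-⊆ (pairs n) (bits g) ij∈))

  count-incident : (v : Fin n) (es : List (Fin n × Fin n)) → Loopless es →
    length (filterᵇ (incident v) es) ≡ ∑ˡ (ends v) es
  count-incident v es loopless = trans (length-filterᵇ (incident v) es) (∑ˡ-cong es (λ e e∈ → not-both e e∈))
    where
    not-both : ∀ e → e ∈ es → 𝟙 (incident v e) ≡ ends v e
    not-both (i , j) e∈ = 𝟙-∨ (v == i) (v == j) (λ (v=i , v=j) → loopless e∈ (trans (sym (==⇒≡ v=i)) (==⇒≡ v=j)))

  ∑-ends : (e : Fin n × Fin n) → ∑[ v < n ] ends v e ≡ 2
  ∑-ends (i , j) = begin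
      ∑[ v < n ] (𝟙 (v == i) + 𝟙 (v == j))
        ≡⟨ ∑-distrib-+ (λ v → 𝟙 (v == i)) (λ v → 𝟙 (v == j)) ⟩
      ∑[ v < n ] 𝟙 (v == i) + ∑[ v < n ] 𝟙 (v == j)
        ≡⟨ cong₂ _+_ (∑-𝟙==ᵀ i) (∑-𝟙==ᵀ j) ⟩
      2 ∎
    where
    open ≡-Reasoning
    ∑-𝟙==ᵀ : (w : Fin n) → ∑[ v < n ] 𝟙 (v == w) ≡ 1
    ∑-𝟙==ᵀ w = trans (sum-cong-≗ (λ v → cong 𝟙 (==-sym v w))) (∑-𝟙== w)

  handshake : (g : Graph n) → ∑[ v < n ] degree g v ≡ 2 * length (edges g)
  handshake g = begin
      ∑[ v < n ] degree g v
        ≡⟨ sum-cong-≗ (λ v → count-incident v (edges g) (edges-loopless g)) ⟩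
      ∑[ v < n ] ∑ˡ (ends v) (edges g)
        ≡⟨ sym (∑ˡ-∑ (λ e v → ends v e) (edges g)) ⟩
      ∑ˡ (λ e → ∑[ v < n ] ends v e) (edges g)
        ≡⟨ ∑ˡ-cong (edges g) (λ e _ → ∑-ends e) ⟩
      ∑ˡ (λ _ → 2) (edges g)
        ≡⟨ ∑ˡ-const 2 (edges g) ⟩
      2 * length (edges g) ∎
    where open ≡-Reasoning

  adjacent-sym : (g : Graph n) (i j : Fin n) → adjacent g i j ≡ adjacent g j i
  adjacent-sym g i j = ∨-comm (edgeBit g i j) (edgeBit g j i)

  adjacent-graphOf : (h : Fin n → Fin n → Bool) → (∀ i j → h i j ≡ h j i) → (∀ i → h i i ≡ false) →
    ∀ i j → adjacent (graphOf h) i j ≡ h i j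
  adjacent-graphOf h h-sym h-irrefl i j rewrite edgeBit-graphOf h i j | edgeBit-graphOf h j i with i Fin.≟ j
  ... | yes refl rewrite <ᵇ-irrefl i | h-irrefl i = refl
  ... | no i≢j with i <ᵇ j in i<j
  ...   | true rewrite <ᵇ-asym i<j = ∨-identityʳ (h i j)
  ...   | false rewrite ≮ᵇ⇒>ᵇ i≢j i<j = h-sym j i

  module _ {g : Graph n} (g∈ : g ∈ allGraphs n) where

    edges-wf : edges g ≡ filterᵇ (λ (i , j) → edgeBit g i j) (pairs n)
    edges-wf = trans (cong (selectEdges (pairs n)) (cong bits (graphOf-edgeBit g∈))) (selectEdges-map _ (pairs n))

    edgeBit-wf : ∀ i j → edgeBit g i j ≡ (i <ᵇ j) ∧ edgeBit g i j
    edgeBit-wf i j = trans (cong (λ g′ → edgeBit g′ i j) (graphOf-edgeBit g∈)) (edgeBit-graphOf (edgeBit g) i j)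

    edgeBit⇒<ᵇ : ∀ {i j} → edgeBit g i j ≡ true → (i <ᵇ j) ≡ true
    edgeBit⇒<ᵇ {i} {j} ij with i <ᵇ j in i<j
    ... | true = refl
    ... | false = ⊥-elim (true≢false (trans (sym ij) (trans (edgeBit-wf i j) (cong (_∧ edgeBit g i j) i<j))))

    adjacent-irrefl : ∀ i → adjacent g i i ≡ false
    adjacent-irrefl i with edgeBit g i i in ii
    ... | true = ⊥-elim (true≢false (trans (sym (edgeBit⇒<ᵇ ii)) (<ᵇ-irrefl i)))
    ... | false = refl

    edgeBit≡adjacent : ∀ {i j} → (i <ᵇ j) ≡ true → edgeBit g i j ≡ adjacent g i j
    edgeBit≡adjacent {i} {j} i<j with edgeBit g j i in ji
    ... | false = sym (∨-identityʳ (edgeBit g i j))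
    ... | true = ⊥-elim (true≢false (trans (sym (edgeBit⇒<ᵇ ji)) (<ᵇ-asym i<j)))

    ∈-edges⁺ : ∀ {i j} → edgeBit g i j ≡ true → (i , j) ∈ edges g
    ∈-edges⁺ ij = subst ((_ , _) ∈_) (sym edges-wf) (∈-filterᵇ⁺ (λ (i , j) → edgeBit g i j) (∈-pairs⁺ (edgeBit⇒<ᵇ ij)) ij)

    ∈-edges⁻ : ∀ {i j} → (i , j) ∈ edges g → edgeBit g i j ≡ true
    ∈-edges⁻ ij∈ = proj₂ (∈-filterᵇ⁻ (λ (i , j) → edgeBit g i j) {xs = pairs n} (subst ((_ , _) ∈_) edges-wf ij∈))

    degree-adjacent : ∀ v → degree g v ≡ ∑[ u < n ] 𝟙 (adjacent g v u)
    degree-adjacent v = begin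
        degree g v
          ≡⟨ count-incident v (edges g) (edges-loopless g) ⟩
        ∑ˡ (ends v) (edges g)
          ≡⟨ cong (∑ˡ (ends v)) edges-wf ⟩
        ∑ˡ (ends v) (filterᵇ (λ (i , j) → edgeBit g i j) (pairs n))
          ≡⟨ ∑ˡ-filterᵇ (ends v) _ (pairs n) ⟩
        ∑ˡ (λ (i , j) → 𝟙 (edgeBit g i j) * ends v (i , j)) (pairs n)
          ≡⟨ ∑-pairs (λ (i , j) → E i j * ends v (i , j)) ⟩
        ∑[ i < n ] ∑[ j < n ] (𝟙 (i <ᵇ j) * (E i j * ends v (i , j)))
          ≡⟨ sum-cong-≗ (λ i → sum-cong-≗ (λ j → split i j)) ⟩
        ∑[ i < n ] ∑[ j < n ] (𝟙 (v == i) * E i j + 𝟙 (v == j) * E i j)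
          ≡⟨ trans (sum-cong-≗ (λ i → ∑-distrib-+ (λ j → 𝟙 (v == i) * E i j) (λ j → 𝟙 (v == j) * E i j)))
                   (∑-distrib-+ (λ i → ∑[ j < n ] (𝟙 (v == i) * E i j)) (λ i → ∑[ j < n ] (𝟙 (v == j) * E i j))) ⟩
        ∑[ i < n ] ∑[ j < n ] (𝟙 (v == i) * E i j) + ∑[ i < n ] ∑[ j < n ] (𝟙 (v == j) * E i j)
          ≡⟨ cong₂ _+_ (trans (sum-cong-≗ (λ i → sym (*-distribˡ-sum (𝟙 (v == i)) (E i)))) (∑-delta v (sum ∘ E)))
                       (trans (∑-comm (λ i j → 𝟙 (v == j) * E i j))
                              (trans (sum-cong-≗ (λ j → sym (*-distribˡ-sum (𝟙 (v == j)) (λ i → E i j))))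
                                     (∑-delta v (λ j → ∑[ i < n ] E i j)))) ⟩
        ∑[ u < n ] E v u + ∑[ u < n ] E u v
          ≡⟨ sym (∑-distrib-+ (E v) (λ u → E u v)) ⟩
        ∑[ u < n ] (E v u + E u v)
          ≡⟨ sum-cong-≗ (λ u → sym (𝟙-∨ (edgeBit g v u) (edgeBit g u v) (not-both u))) ⟩
        ∑[ u < n ] 𝟙 (adjacent g v u) ∎
      where
      open ≡-Reasoning
      E : Fin n → Fin n → ℕ
      E i j = 𝟙 (edgeBit g i j)
      not-both : ∀ u → ¬ (edgeBit g v u ≡ true × edgeBit g u v ≡ true)
      not-both u (vu , uv) = true≢false (trans (sym (edgeBit⇒<ᵇ uv)) (<ᵇ-asym (edgeBit⇒<ᵇ vu)))
      split : ∀ i j → 𝟙 (i <ᵇ j) * (E i j * ends v (i , j)) ≡ 𝟙 (v == i) * E i j + 𝟙 (v == j) * E i j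
      split i j with edgeBit g i j in ij
      ... | false = trans (*-zeroʳ (𝟙 (i <ᵇ j))) (sym (cong₂ _+_ (*-zeroʳ (𝟙 (v == i))) (*-zeroʳ (𝟙 (v == j)))))
      ... | true rewrite edgeBit⇒<ᵇ ij =
        trans (+-identityʳ (ends v (i , j) + 0)) (trans (+-identityʳ (ends v (i , j)))
          (sym (cong₂ _+_ (*-identityʳ (𝟙 (v == i))) (*-identityʳ (𝟙 (v == j))))))

degree-split : {m : ℕ} {G : Graph (suc m)} → G ∈ allGraphs (suc m) → (ℓ v : Fin (suc m)) →
  degree G v ≡ 𝟙 (adjacent G v ℓ) + ∑[ b < m ] 𝟙 (adjacent G v (punchIn ℓ b))
degree-split {G = G} G∈ ℓ v = trans (degree-adjacent G∈ v) (sum-remove {i = ℓ} (𝟙 ∘ adjacent G v))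

-- Paths and the connectivity test

Adjacent : {n : ℕ} → Graph n → Fin n → Fin n → Set
Adjacent g i j = adjacent g i j ≡ true

Path : {n : ℕ} → Graph n → Fin n → Fin n → Set
Path g = Star (Adjacent g)

path-sym : {n : ℕ} (g : Graph n) {i j : Fin n} → Path g i j → Path g j i
path-sym g = Star.reverse (λ {i} {j} ij → trans (adjacent-sym g j i) ij)

enters : {n : ℕ} → (Fin n → Bool) → Fin n → Fin n × Fin n → Bool
enters r v (a , b) = (r a ∧ (v == b)) ∨ (r b ∧ (v == a))

step-keeps : {n : ℕ} (g : Graph n) (r : Fin n → Bool) {v : Fin n} → r v ≡ true → step g r v ≡ true
step-keeps g r rv rewrite rv = refl

module _ {n : ℕ} {g : Graph n} (g∈ : g ∈ allGraphs n) where

  step-extends : (r : Fin n → Bool) {u v : Fin n} → r u ≡ true → Adjacent g u v → step g r v ≡ true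
  step-extends r {u} {v} ru uv = ∨-introʳ (r v) (via (∨-elim uv))
    where
    via : edgeBit g u v ≡ true ⊎ edgeBit g v u ≡ true → or (map (enters r v) (edges g)) ≡ true
    via (inj₁ uv) = or-map⁺ (enters r v) (∈-edges⁺ g∈ uv) (cong (_∨ (r v ∧ (v == u))) (cong₂ _∧_ ru (==-refl v)))
    via (inj₂ vu) = or-map⁺ (enters r v) (∈-edges⁺ g∈ vu) (∨-introʳ (r v ∧ (v == u)) (cong₂ _∧_ ru (==-refl v)))

  step-sound : (r : Fin n → Bool) {v : Fin n} → step g r v ≡ true →
    r v ≡ true ⊎ Σ[ u ∈ Fin n ] r u ≡ true × Adjacent g u v
  step-sound r {v} stepped with ∨-elim {r v} stepped
  ... | inj₁ rv = inj₁ rv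
  ... | inj₂ entered with (a , b) , ab∈ , ab ← or-map⁻ (enters r v) entered with ∨-elim ab
  ...   | inj₁ forward with ra , v=b ← ∧-elim forward =
          inj₂ (a , ra , subst (Adjacent g a) (sym (==⇒≡ v=b)) (cong (_∨ edgeBit g b a) (∈-edges⁻ g∈ ab∈)))
  ...   | inj₂ backward with rb , v=a ← ∧-elim backward =
          inj₂ (b , rb , subst (Adjacent g b) (sym (==⇒≡ v=a)) (∨-introʳ (edgeBit g b a) (∈-edges⁻ g∈ ab∈)))

module _ {m : ℕ} {g : Graph (suc m)} (g∈ : g ∈ allGraphs (suc m)) where

  reached : ℕ → Fin (suc m) → Bool
  reached k = iter k (step g) (_== zero)

  reached-zero : ∀ k → reached k zero ≡ true
  reached-zero zero = refl
  reached-zero (suc k) = step-keeps g (reached k) (reached-zero k)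

  reached-sound : ∀ k {v} → reached k v ≡ true → Path g zero v
  reached-sound zero r0 = subst (Path g zero) (sym (==⇒≡ r0)) ε
  reached-sound (suc k) rv with step-sound g∈ (reached k) rv
  ... | inj₁ rv′ = reached-sound k rv′
  ... | inj₂ (u , ru , uv) = reached-sound k ru ◅◅ uv ◅ ε

  Closed : (Fin (suc m) → Bool) → Set
  Closed r = ∀ {u v} → r u ≡ true → Adjacent g u v → r v ≡ true

  closed-path : {r : Fin (suc m) → Bool} → Closed r → ∀ {u v} → Path g u v → r u ≡ true → r v ≡ true
  closed-path closed ε ru = ru
  closed-path closed (uw ◅ wv) ru = closed-path closed wv (closed ru uw)

  closed-step : {r : Fin (suc m) → Bool} → Closed r → ∀ {v} → step g r v ≡ true → r v ≡ true
  closed-step {r} closed stepped with step-sound g∈ r stepped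
  ... | inj₁ rv = rv
  ... | inj₂ (u , ru , uv) = closed ru uv

  -- Each round adds a vertex unless the reached set is already closed under adjacency, so suc m rounds suffice.
  closed-or-large : ∀ k → Closed (reached k) ⊎ suc k ≤ size (reached k)
  closed-or-large zero = inj₂ (s≤s z≤n)
  closed-or-large (suc k) with closed-or-large k
  ... | inj₁ closed = inj₁ (λ ru uv → step-keeps g (reached k) (closed (closed-step closed ru) uv))
  ... | inj₂ large with Fin.any? (λ v → reached (suc k) v Data.Bool.≟ true ×-dec reached k v Data.Bool.≟ false)
  ...   | yes (w , new , old) = inj₂ (≤-trans (s≤s large) (size-strict {r = reached k} (step-keeps g (reached k)) new old))
  ...   | no nothing-new = inj₁ (λ ru uv → step-keeps g (reached k) (stable (step-extends g∈ (reached k) (stable ru) uv)))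
    where
    stable : ∀ {v} → reached (suc k) v ≡ true → reached k v ≡ true
    stable {v} new with reached k v Data.Bool.≟ true
    ... | yes old = old
    ... | no not-old = ⊥-elim (nothing-new (v , new , ¬-not not-old))

  connectedᵇ-sound : connectedᵇ g ≡ true → ∀ v → Path g zero v
  connectedᵇ-sound conn v = reached-sound (suc m) (and-map⁻ (reached (suc m)) {xs = allFin (suc m)} conn (∈-allFin v))

  connectedᵇ-complete : (∀ v → Path g zero v) → connectedᵇ g ≡ true
  connectedᵇ-complete paths = and-map⁺ (reached (suc m)) {xs = allFin (suc m)} (λ {v} _ → everything-reached v)
    where
    everything-reached : ∀ v → reached (suc m) v ≡ true
    everything-reached v with closed-or-large m
    ... | inj₁ closed = step-keeps g (reached m) (closed-path closed (paths v) (reached-zero m))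
    ... | inj₂ large = step-keeps g (reached m) (size-full (reached m) large v)

TreeDegreeSum : (n : ℕ) → DegSeq n → Set
TreeDegreeSum n d = ℕL.sum (map d (allFin n)) + 2 ≡ 2 * n

record TreeRealization {m : ℕ} (d : DegSeq (suc m)) (g : Graph (suc m)) : Set where
  field
    wellFormed : g ∈ allGraphs (suc m)
    degrees : ∀ v → degree g v ≡ d v
    connected : ∀ v → Path g zero v

-- Opaque, so that a failed conversion check cannot unfold the enumeration of all graphs (which blows up).
opaque
  trees : {n : ℕ} → DegSeq n → List (Graph n)
  trees = treeRealizations

  trees≡treeRealizations : {n : ℕ} (d : DegSeq n) → trees d ≡ treeRealizations d
  trees≡treeRealizations d = refl

module _ {m : ℕ} (d : DegSeq (suc m)) where

  length-edges : {g : Graph (suc m)} → TreeDegreeSum (suc m) d → (∀ v → degree g v ≡ d v) → length (edges g) ≡ m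
  length-edges {g} sum-d degrees = suc-injective (*-cancelˡ-≡ _ _ 2 (begin
      2 * suc (length (edges g))         ≡⟨ *-suc 2 (length (edges g)) ⟩
      2 + 2 * length (edges g)           ≡⟨ +-comm 2 _ ⟩
      2 * length (edges g) + 2           ≡⟨ cong (_+ 2) (sym (handshake g)) ⟩
      ∑[ v < suc m ] degree g v + 2      ≡⟨ cong (_+ 2) (trans (sum-cong-≗ degrees) (sym (∑ˡ-allFin d))) ⟩
      ℕL.sum (map d (allFin (suc m))) + 2 ≡⟨ sum-d ⟩
      2 * suc m                           ∎))
    where open ≡-Reasoning

  ∈-trees⁻ : {g : Graph (suc m)} → g ∈ trees d → TreeRealization d g
  ∈-trees⁻ {g} g∈
    with g∈all , realizes∧tree ← ∈-filterᵇ⁻ (λ g → realizesᵇ d g ∧ isTreeᵇ g) {xs = allGraphs (suc m)}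
                                   (subst (g ∈_) (trees≡treeRealizations d) g∈)
    with realizes , tree ← ∧-elim {realizesᵇ d g} realizes∧tree = record
    { wellFormed = g∈all
    ; degrees = λ v → ⌊⌋≡true⁻ (and-map⁻ (λ v → ⌊ degree g v ℕ.≟ d v ⌋) {xs = allFin (suc m)} realizes (∈-allFin v))
    ; connected = connectedᵇ-sound g∈all (proj₁ (∧-elim {connectedᵇ g} tree))
    }

  ∈-trees⁺ : TreeDegreeSum (suc m) d → {g : Graph (suc m)} → TreeRealization d g → g ∈ trees d
  ∈-trees⁺ sum-d {g} tree = subst (g ∈_) (sym (trees≡treeRealizations d)) (∈-filterᵇ⁺ (λ g → realizesᵇ d g ∧ isTreeᵇ g) wellFormed
    (cong₂ _∧_ (and-map⁺ (λ v → ⌊ degree g v ℕ.≟ d v ⌋) {xs = allFin (suc m)} (λ {v} _ → ⌊⌋≡true⁺ (degrees v)))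
               (cong₂ _∧_ (connectedᵇ-complete wellFormed connected)
                          (⌊⌋≡true⁺ {p? = length (edges g) ℕ.≟ m} (length-edges sum-d degrees)))))
    where open TreeRealization tree

trees-unique : {n : ℕ} (d : DegSeq n) → Unique (trees d)
trees-unique {n} d = subst Unique (sym (trees≡treeRealizations d)) (unique-filterᵇ _ (allGraphs-unique n))

treeRealizations-cong : {n : ℕ} {d e : DegSeq n} → (∀ v → d v ≡ e v) → treeRealizations d ≡ treeRealizations e
treeRealizations-cong {n} {d} {e} d≗e =
  List.filter-≐ (T? ∘ accepts d) (T? ∘ accepts e) ((λ {g} → subst T (same g)) , (λ {g} → subst T (sym (same g)))) (allGraphs n)
  where
  accepts : DegSeq n → Graph n → Bool
  accepts d g = realizesᵇ d g ∧ isTreeᵇ g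
  same : ∀ g → accepts d g ≡ accepts e g
  same g = cong (λ r → r ∧ isTreeᵇ g) (cong and (List.map-cong (λ v → cong (λ x → ⌊ degree g v ℕ.≟ x ⌋) (d≗e v)) (allFin n)))

#trees : {n : ℕ} → DegSeq n → ℕ
#trees d = length (trees d)

leaf-has-one-neighbour : {m : ℕ} {d : DegSeq (suc m)} {G : Graph (suc m)} → TreeRealization d G →
  {ℓ : Fin (suc m)} → d ℓ ≡ 1 → ∑[ b < m ] 𝟙 (adjacent G ℓ (punchIn ℓ b)) ≡ 1
leaf-has-one-neighbour {m} {d} {G} tree {ℓ} dℓ = begin
    ∑[ b < m ] 𝟙 (adjacent G ℓ (punchIn ℓ b))
      ≡⟨ cong (λ x → 𝟙 x + ∑[ b < m ] 𝟙 (adjacent G ℓ (punchIn ℓ b))) (sym (adjacent-irrefl wellFormed ℓ)) ⟩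
    𝟙 (adjacent G ℓ ℓ) + ∑[ b < m ] 𝟙 (adjacent G ℓ (punchIn ℓ b))
      ≡⟨ sym (degree-split wellFormed ℓ ℓ) ⟩
    degree G ℓ
      ≡⟨ trans (degrees ℓ) dℓ ⟩
    1 ∎
  where
  open ≡-Reasoning
  open TreeRealization tree

isolated⇒no-trees : {m : ℕ} (d : DegSeq (suc (suc m))) {k : Fin (suc (suc m))} → d k ≡ 0 → #trees d ≡ 0
isolated⇒no-trees {m} d {k} dk = length-∅ (trees d) (no-tree ∘ ∈-trees⁻ d)
  where
  other : Fin (suc (suc m))
  other = punchIn k zero
  first-step : {G : Graph (suc (suc m))} {u : Fin (suc (suc m))} → Path G k u → k ≢ u → Σ[ z ∈ Fin (suc (suc m)) ] Adjacent G k z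
  first-step ε k≢k = ⊥-elim (k≢k refl)
  first-step (kz ◅ _) _ = _ , kz
  no-tree : ∀ {G} → TreeRealization d G → ⊥
  no-tree {G} tree = no-neighbour (first-step {G} (path-sym G (connected k) ◅◅ connected other) (punchIn≢ k zero))
    where
    open TreeRealization tree
    no-neighbour : Σ[ z ∈ Fin (suc (suc m)) ] Adjacent G k z → ⊥
    no-neighbour (z , kz) = true≢false (trans (sym kz) (𝟙≡0⇒ (∑≡0⇒ (𝟙 ∘ adjacent G k) isolated z)))
      where
      isolated : ∑[ u < suc (suc m) ] 𝟙 (adjacent G k u) ≡ 0
      isolated = trans (sym (degree-adjacent wellFormed k)) (trans (degrees k) dk)

leaf-exists : {n : ℕ} (d : DegSeq n) → TreeDegSeq n d → Σ[ ℓ ∈ Fin n ] d ℓ ≡ 1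
leaf-exists {n} d (d-pos , sum-d) with Fin.any? (λ v → d v ℕ.≟ 1)
... | yes leaf = leaf
... | no no-leaf = ⊥-elim (<-irrefl refl (begin-strict
    2 * n                       ≤⟨ subst₂ _≤_ (trans (∑-const n 2) (*-comm n 2)) (sym (∑ˡ-allFin d)) (∑-mono-≤ ≥2) ⟩
    ℕL.sum (map d (allFin n))   <⟨ m<m+n _ (s≤s z≤n) ⟩
    ℕL.sum (map d (allFin n)) + 2 ≡⟨ sum-d ⟩
    2 * n                       ∎))
  where
  open ≤-Reasoning
  ≥2 : ∀ v → 2 ≤ d v
  ≥2 v with d v | d-pos v | no-leaf ∘ (v ,_)
  ... | suc zero | _ | ≢1 = ⊥-elim (≢1 refl)
  ... | suc (suc _) | _ | _ = s≤s (s≤s z≤n)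

∑-excess : {m : ℕ} (d : DegSeq (suc (suc m))) → TreeDegSeq _ d → ∑[ i < suc (suc m) ] (d i ∸ 1) ≡ m
∑-excess {m} d (d-pos , sum-d) = +-cancelʳ-≡ (suc (suc m)) _ _ (+-cancelʳ-≡ 2 _ _ (begin
    ∑[ i < n ] (d i ∸ 1) + n + 2           ≡⟨ cong (λ x → ∑[ i < n ] (d i ∸ 1) + x + 2) (sym ∑-ones) ⟩
    ∑[ i < n ] (d i ∸ 1) + ∑[ i < n ] 1 + 2 ≡⟨ cong (_+ 2) (sym (∑-distrib-+ (λ i → d i ∸ 1) (λ _ → 1))) ⟩
    ∑[ i < n ] (d i ∸ 1 + 1) + 2           ≡⟨ cong (_+ 2) (trans (sum-cong-≗ (λ i → m∸n+n≡m (d-pos i))) (sym (∑ˡ-allFin d))) ⟩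
    ℕL.sum (map d (allFin n)) + 2          ≡⟨ sum-d ⟩
    2 * n                                   ≡⟨ cong (n +_) (+-identityʳ n) ⟩
    n + n                                   ≡⟨ +-comm 2 (m + n) ⟩
    m + n + 2                               ∎))
  where
  open ≡-Reasoning
  n : ℕ
  n = suc (suc m)
  ∑-ones : ∑[ i < n ] 1 ≡ n
  ∑-ones = trans (∑-const n 1) (*-identityʳ n)

two-vertex-leaves : (d : DegSeq 2) → TreeDegSeq 2 d → ∀ v → d v ≡ 1
two-vertex-leaves d (d-pos , sum-d) = leaf
  where
  both-one : ∀ {x y} → 1 ≤ x → 1 ≤ y → x + y ≡ 2 → x ≡ 1 × y ≡ 1
  both-one {suc x} {suc y} _ _ eq with x+y≡0 ← suc-injective (trans (sym (+-suc x y)) (suc-injective eq)) =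
    cong suc (m+n≡0⇒m≡0 x x+y≡0) , cong suc (m+n≡0⇒n≡0 x x+y≡0)
  both-ends : d zero ≡ 1 × d (suc zero) ≡ 1
  both-ends = both-one (d-pos zero) (d-pos (suc zero))
    (trans (cong (d zero +_) (sym (+-identityʳ (d (suc zero))))) (+-cancelʳ-≡ 2 _ _ sum-d))
  leaf : ∀ v → d v ≡ 1
  leaf zero = proj₁ both-ends
  leaf (suc zero) = proj₂ both-ends

no-one-vertex-tree : (d : DegSeq 1) → ¬ TreeDegSeq 1 d
no-one-vertex-tree d (d-pos , sum-d) = <-irrefl refl (≤-trans (d-pos zero) (≤-reflexive d0≡0))
  where
  d0≡0 : d zero ≡ 0
  d0≡0 = m+n≡0⇒m≡0 (d zero) (+-cancelʳ-≡ 2 (d zero + 0) 0 sum-d)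

-- Removing a leaf

-- ℓ is the leaf; the other vertices are numbered through punchIn ℓ, and k is the neighbour of ℓ in that numbering.
module LeafSurgery {m : ℕ} (ℓ : Fin (suc (suc m))) (k : Fin (suc m)) where

  private
    V V′ : Set
    V = Fin (suc (suc m))
    V′ = Fin (suc m)

  attachAdjacency : Graph (suc m) → {i j : V} → Dec (ℓ ≡ i) → Dec (ℓ ≡ j) → Bool
  attachAdjacency Y (yes _) (yes _) = false
  attachAdjacency Y (yes _) (no ℓ≢j) = k == punchOut ℓ≢j
  attachAdjacency Y (no ℓ≢i) (yes _) = k == punchOut ℓ≢i
  attachAdjacency Y (no ℓ≢i) (no ℓ≢j) = adjacent Y (punchOut ℓ≢i) (punchOut ℓ≢j)

  attached : Graph (suc m) → V → V → Bool
  attached Y i j = attachAdjacency Y (ℓ Fin.≟ i) (ℓ Fin.≟ j)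

  attached-ℓℓ : (Y : Graph (suc m)) → attached Y ℓ ℓ ≡ false
  attached-ℓℓ Y with ℓ Fin.≟ ℓ
  ... | yes _ = refl
  ... | no ℓ≢ℓ = ⊥-elim (ℓ≢ℓ refl)

  attached-ℓb : (Y : Graph (suc m)) (b : V′) → attached Y ℓ (punchIn ℓ b) ≡ (k == b)
  attached-ℓb Y b with ℓ Fin.≟ ℓ | ℓ Fin.≟ punchIn ℓ b
  ... | no ℓ≢ℓ | _ = ⊥-elim (ℓ≢ℓ refl)
  ... | yes _ | yes ℓ≡ = ⊥-elim (punchIn≢ ℓ b ℓ≡)
  ... | yes _ | no ℓ≢ = cong (k ==_) (punchOut-punchIn ℓ b ℓ≢)

  attached-aℓ : (Y : Graph (suc m)) (a : V′) → attached Y (punchIn ℓ a) ℓ ≡ (k == a)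
  attached-aℓ Y a with ℓ Fin.≟ punchIn ℓ a | ℓ Fin.≟ ℓ
  ... | _ | no ℓ≢ℓ = ⊥-elim (ℓ≢ℓ refl)
  ... | yes ℓ≡ | yes _ = ⊥-elim (punchIn≢ ℓ a ℓ≡)
  ... | no ℓ≢ | yes _ = cong (k ==_) (punchOut-punchIn ℓ a ℓ≢)

  attached-ab : (Y : Graph (suc m)) (a b : V′) → attached Y (punchIn ℓ a) (punchIn ℓ b) ≡ adjacent Y a b
  attached-ab Y a b with ℓ Fin.≟ punchIn ℓ a | ℓ Fin.≟ punchIn ℓ b
  ... | yes ℓ≡ | _ = ⊥-elim (punchIn≢ ℓ a ℓ≡)
  ... | no _ | yes ℓ≡ = ⊥-elim (punchIn≢ ℓ b ℓ≡)
  ... | no ℓ≢a | no ℓ≢b = cong₂ (adjacent Y) (punchOut-punchIn ℓ a ℓ≢a) (punchOut-punchIn ℓ b ℓ≢b)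

  attached-sym : (Y : Graph (suc m)) → ∀ i j → attached Y i j ≡ attached Y j i
  attached-sym Y i j with punchIn-view ℓ i | punchIn-view ℓ j
  ... | inj₁ refl | inj₁ refl = refl
  ... | inj₁ refl | inj₂ (b , refl) = trans (attached-ℓb Y b) (sym (attached-aℓ Y b))
  ... | inj₂ (a , refl) | inj₁ refl = trans (attached-aℓ Y a) (sym (attached-ℓb Y a))
  ... | inj₂ (a , refl) | inj₂ (b , refl) = trans (attached-ab Y a b) (trans (adjacent-sym Y a b) (sym (attached-ab Y b a)))

  attached-irrefl : {Y : Graph (suc m)} → Y ∈ allGraphs (suc m) → ∀ i → attached Y i i ≡ false
  attached-irrefl {Y} Y∈ = punchIn-elim ℓ (λ i → attached Y i i ≡ false)
    (attached-ℓℓ Y) (λ a → trans (attached-ab Y a a) (adjacent-irrefl Y∈ a))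

  attachLeaf : Graph (suc m) → Graph (suc (suc m))
  attachLeaf Y = graphOf (attached Y)

  removeLeaf : Graph (suc (suc m)) → Graph (suc m)
  removeLeaf G = graphOf (λ a b → adjacent G (punchIn ℓ a) (punchIn ℓ b))

  adjacent-attachLeaf : {Y : Graph (suc m)} → Y ∈ allGraphs (suc m) → ∀ i j → adjacent (attachLeaf Y) i j ≡ attached Y i j
  adjacent-attachLeaf {Y} Y∈ = adjacent-graphOf (attached Y) (attached-sym Y) (attached-irrefl Y∈)

  adjacent-removeLeaf : {G : Graph (suc (suc m))} → G ∈ allGraphs (suc (suc m)) →
    ∀ a b → adjacent (removeLeaf G) a b ≡ adjacent G (punchIn ℓ a) (punchIn ℓ b)
  adjacent-removeLeaf {G} G∈ = adjacent-graphOf _ (λ a b → adjacent-sym G (punchIn ℓ a) (punchIn ℓ b))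
    (λ a → adjacent-irrefl G∈ (punchIn ℓ a))

  degree-removeLeaf : {G : Graph (suc (suc m))} → G ∈ allGraphs (suc (suc m)) → ∀ a →
    degree G (punchIn ℓ a) ≡ 𝟙 (adjacent G (punchIn ℓ a) ℓ) + degree (removeLeaf G) a
  degree-removeLeaf {G} G∈ a = trans (degree-split G∈ ℓ (punchIn ℓ a))
    (cong (𝟙 (adjacent G (punchIn ℓ a) ℓ) +_) (sym (trans (degree-adjacent (graphOf-∈-allGraphs _) a)
      (sum-cong-≗ (λ b → cong 𝟙 (adjacent-removeLeaf G∈ a b))))))

  degree-attachLeaf-ℓ : {Y : Graph (suc m)} → Y ∈ allGraphs (suc m) → degree (attachLeaf Y) ℓ ≡ 1
  degree-attachLeaf-ℓ {Y} Y∈ = trans (degree-split (graphOf-∈-allGraphs _) ℓ ℓ)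
    (cong₂ _+_ (cong 𝟙 (trans (adjacent-attachLeaf Y∈ ℓ ℓ) (attached-ℓℓ Y)))
               (trans (sum-cong-≗ (λ b → cong 𝟙 (trans (adjacent-attachLeaf Y∈ ℓ (punchIn ℓ b)) (attached-ℓb Y b))))
                      (∑-𝟙== k)))

  degree-attachLeaf : {Y : Graph (suc m)} → Y ∈ allGraphs (suc m) → ∀ a →
    degree (attachLeaf Y) (punchIn ℓ a) ≡ 𝟙 (k == a) + degree Y a
  degree-attachLeaf {Y} Y∈ a = trans (degree-split (graphOf-∈-allGraphs _) ℓ (punchIn ℓ a))
    (cong₂ _+_ (cong 𝟙 (trans (adjacent-attachLeaf Y∈ (punchIn ℓ a) ℓ) (attached-aℓ Y a)))
               (trans (sum-cong-≗ (λ b → cong 𝟙 (trans (adjacent-attachLeaf Y∈ (punchIn ℓ a) (punchIn ℓ b)) (attached-ab Y a b))))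
                      (sym (degree-adjacent Y∈ a))))

  collapse : V → V′
  collapse i with ℓ Fin.≟ i
  ... | yes _ = k
  ... | no ℓ≢i = punchOut ℓ≢i

  collapse-ℓ : collapse ℓ ≡ k
  collapse-ℓ with ℓ Fin.≟ ℓ
  ... | yes _ = refl
  ... | no ℓ≢ℓ = ⊥-elim (ℓ≢ℓ refl)

  collapse-punchIn : ∀ a → collapse (punchIn ℓ a) ≡ a
  collapse-punchIn a with ℓ Fin.≟ punchIn ℓ a
  ... | yes ℓ≡ = ⊥-elim (punchIn≢ ℓ a ℓ≡)
  ... | no ℓ≢ = punchOut-punchIn ℓ a ℓ≢

  module _ (d : DegSeq (suc (suc m))) where

    reduced : DegSeq (suc m)
    reduced a = d (punchIn ℓ a) ∸ 𝟙 (k == a)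

    withEdge : List (Graph (suc (suc m)))
    withEdge = filterᵇ (λ G → adjacent G ℓ (punchIn ℓ k)) (trees d)

    module _ (sum-d : TreeDegreeSum (suc (suc m)) d) (d-pos : ∀ v → 1 ≤ d v) (dℓ : d ℓ ≡ 1) where

      private
        𝟙≤d : ∀ a → 𝟙 (k == a) ≤ d (punchIn ℓ a)
        𝟙≤d a = ≤-trans (𝟙≤1 (k == a)) (d-pos (punchIn ℓ a))

      reduced-sum : TreeDegreeSum (suc m) reduced
      reduced-sum = +-cancelʳ-≡ 2 _ _ (begin
          ℕL.sum (map reduced (allFin (suc m))) + 2 + 2   ≡⟨ cong (λ x → x + 2 + 2) (∑ˡ-allFin reduced) ⟩
          sum reduced + 2 + 2                              ≡⟨ shuffle (sum reduced) ⟩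
          2 + (1 + (sum reduced + 1))                      ≡⟨ cong (λ x → 2 + (x + (sum reduced + 1))) (sym dℓ) ⟩
          2 + (d ℓ + (sum reduced + 1))                    ≡⟨ cong (λ x → 2 + (d ℓ + x)) reduced+1 ⟩
          2 + (d ℓ + ∑[ a < suc m ] d (punchIn ℓ a))       ≡⟨ cong (2 +_) (sym (sum-remove {i = ℓ} d)) ⟩
          2 + sum d                                        ≡⟨ trans (+-comm 2 (sum d)) (cong (_+ 2) (sym (∑ˡ-allFin d))) ⟩
          ℕL.sum (map d (allFin (suc (suc m)))) + 2        ≡⟨ sum-d ⟩
          2 * suc (suc m)                                  ≡⟨ trans (*-suc 2 (suc m)) (+-comm 2 (2 * suc m)) ⟩
          2 * suc m + 2                                    ∎)
        where
        open ≡-Reasoning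
        shuffle : ∀ x → x + 2 + 2 ≡ 2 + (1 + (x + 1))
        shuffle x = trans (+-comm (x + 2) 2) (cong (2 +_) (trans (+-comm x 2) (cong suc (+-comm 1 x))))
        reduced+1 : sum reduced + 1 ≡ ∑[ a < suc m ] d (punchIn ℓ a)
        reduced+1 = begin
          sum reduced + 1                                           ≡⟨ cong (sum reduced +_) (sym (∑-𝟙== k)) ⟩
          sum reduced + ∑[ a < suc m ] 𝟙 (k == a)                   ≡⟨ sym (∑-distrib-+ reduced (λ a → 𝟙 (k == a))) ⟩
          ∑[ a < suc m ] (reduced a + 𝟙 (k == a))                   ≡⟨ sum-cong-≗ (λ a → m∸n+n≡m (𝟙≤d a)) ⟩
          ∑[ a < suc m ] d (punchIn ℓ a)                            ∎

      module _ {G : Graph (suc (suc m))} (G∈ : G ∈ withEdge) where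

        private
          G-tree : TreeRealization d G
          G-tree = ∈-trees⁻ d (proj₁ (∈-filterᵇ⁻ _ {xs = trees d} G∈))
          open TreeRealization G-tree

        neighbour-of-ℓ : ∀ b → adjacent G ℓ (punchIn ℓ b) ≡ (k == b)
        neighbour-of-ℓ = ∑-𝟙-unique (λ b → adjacent G ℓ (punchIn ℓ b)) (leaf-has-one-neighbour G-tree dℓ)
          (proj₂ (∈-filterᵇ⁻ _ {xs = trees d} G∈))

        neighbour-of-ℓ′ : ∀ a → adjacent G (punchIn ℓ a) ℓ ≡ (k == a)
        neighbour-of-ℓ′ a = trans (adjacent-sym G (punchIn ℓ a) ℓ) (neighbour-of-ℓ a)

        removeLeaf-degrees : ∀ a → degree (removeLeaf G) a ≡ reduced a
        removeLeaf-degrees a = trans (sym (m+n∸m≡n (𝟙 (k == a)) _)) (cong (_∸ 𝟙 (k == a)) (begin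
            𝟙 (k == a) + degree (removeLeaf G) a
              ≡⟨ cong (λ x → 𝟙 x + degree (removeLeaf G) a) (sym (neighbour-of-ℓ′ a)) ⟩
            𝟙 (adjacent G (punchIn ℓ a) ℓ) + degree (removeLeaf G) a
              ≡⟨ sym (degree-removeLeaf wellFormed a) ⟩
            degree G (punchIn ℓ a)
              ≡⟨ degrees (punchIn ℓ a) ⟩
            d (punchIn ℓ a) ∎))
          where open ≡-Reasoning

        collapse-adjacent : ∀ {x w} → Adjacent G x w → Path (removeLeaf G) (collapse x) (collapse w)
        collapse-adjacent {x} {w} = punchIn-elim ℓ (λ x → Adjacent G x w → Path (removeLeaf G) (collapse x) (collapse w))
          (punchIn-elim ℓ (λ w → Adjacent G ℓ w → Path (removeLeaf G) (collapse ℓ) (collapse w))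
            (λ _ → ε)
            (λ b ℓb → subst₂ (Path (removeLeaf G)) (sym collapse-ℓ)
                        (trans (==⇒≡ (trans (sym (neighbour-of-ℓ b)) ℓb)) (sym (collapse-punchIn b))) ε) w)
          (λ a → punchIn-elim ℓ (λ w → Adjacent G (punchIn ℓ a) w → Path (removeLeaf G) (collapse (punchIn ℓ a)) (collapse w))
            (λ aℓ → subst₂ (Path (removeLeaf G))
                      (trans (==⇒≡ (trans (sym (neighbour-of-ℓ′ a)) aℓ)) (sym (collapse-punchIn a))) (sym collapse-ℓ) ε)
            (λ b ab → subst₂ (Path (removeLeaf G)) (sym (collapse-punchIn a)) (sym (collapse-punchIn b))
                        (trans (adjacent-removeLeaf wellFormed a b) ab ◅ ε)) w)
          x

        removeLeaf-connected : ∀ b → Path (removeLeaf G) zero b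
        removeLeaf-connected b = subst₂ (Path (removeLeaf G)) (collapse-punchIn zero) (collapse-punchIn b)
          (Star.kleisliStar collapse collapse-adjacent (path-sym G (connected (punchIn ℓ zero)) ◅◅ connected (punchIn ℓ b)))

        removeLeaf-∈ : removeLeaf G ∈ trees reduced
        removeLeaf-∈ = ∈-trees⁺ reduced reduced-sum record
          { wellFormed = graphOf-∈-allGraphs _
          ; degrees = removeLeaf-degrees
          ; connected = removeLeaf-connected
          }

        attach-remove : attachLeaf (removeLeaf G) ≡ G
        attach-remove =
          trans (graphOf-cong (λ {i} {j} i<j → trans (attached≡adjacent i j) (sym (edgeBit≡adjacent wellFormed i<j))))
                (sym (graphOf-edgeBit wellFormed))
          where
          attached≡adjacent : ∀ i j → attached (removeLeaf G) i j ≡ adjacent G i j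
          attached≡adjacent i j = punchIn-elim ℓ (λ i → attached (removeLeaf G) i j ≡ adjacent G i j)
            (punchIn-elim ℓ (λ j → attached (removeLeaf G) ℓ j ≡ adjacent G ℓ j)
              (trans (attached-ℓℓ (removeLeaf G)) (sym (adjacent-irrefl wellFormed ℓ)))
              (λ b → trans (attached-ℓb (removeLeaf G) b) (sym (neighbour-of-ℓ b))) j)
            (λ a → punchIn-elim ℓ (λ j → attached (removeLeaf G) (punchIn ℓ a) j ≡ adjacent G (punchIn ℓ a) j)
              (trans (attached-aℓ (removeLeaf G) a) (sym (neighbour-of-ℓ′ a)))
              (λ b → trans (attached-ab (removeLeaf G) a b) (adjacent-removeLeaf wellFormed a b)) j)
            i

      module _ {Y : Graph (suc m)} (Y∈ : Y ∈ trees reduced) where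

        open TreeRealization (∈-trees⁻ reduced Y∈)

        attachLeaf-degrees : ∀ v → degree (attachLeaf Y) v ≡ d v
        attachLeaf-degrees = punchIn-elim ℓ (λ v → degree (attachLeaf Y) v ≡ d v)
          (trans (degree-attachLeaf-ℓ wellFormed) (sym dℓ))
          (λ a → trans (degree-attachLeaf wellFormed a) (trans (cong (𝟙 (k == a) +_) (degrees a)) (m+[n∸m]≡n (𝟙≤d a))))

        lift : ∀ {a b} → Path Y a b → Path (attachLeaf Y) (punchIn ℓ a) (punchIn ℓ b)
        lift = Star.gmap (punchIn ℓ) (λ {a} {b} ab → trans (adjacent-attachLeaf wellFormed _ _) (trans (attached-ab Y a b) ab))

        attachLeaf-connected : ∀ v → Path (attachLeaf Y) zero v
        attachLeaf-connected v = path-sym (attachLeaf Y) (from-root zero) ◅◅ from-root v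
          where
          root : Fin (suc (suc m))
          root = punchIn ℓ zero
          from-root : ∀ v → Path (attachLeaf Y) root v
          from-root = punchIn-elim ℓ (Path (attachLeaf Y) root)
            (lift (path-sym Y (connected zero) ◅◅ connected k)
              ◅◅ trans (adjacent-attachLeaf wellFormed (punchIn ℓ k) ℓ) (trans (attached-aℓ Y k) (==-refl k)) ◅ ε)
            (λ a → lift (path-sym Y (connected zero) ◅◅ connected a))

        attachLeaf-∈ : attachLeaf Y ∈ withEdge
        attachLeaf-∈ = ∈-filterᵇ⁺ _
          (∈-trees⁺ d sum-d record
            { wellFormed = graphOf-∈-allGraphs _
            ; degrees = attachLeaf-degrees
            ; connected = attachLeaf-connected
            })
          (trans (adjacent-attachLeaf wellFormed ℓ (punchIn ℓ k)) (trans (attached-ℓb Y k) (==-refl k)))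

        remove-attach : removeLeaf (attachLeaf Y) ≡ Y
        remove-attach = trans (graphOf-cong (λ {a} {b} a<b →
            trans (adjacent-attachLeaf wellFormed (punchIn ℓ a) (punchIn ℓ b))
                  (trans (attached-ab Y a b) (sym (edgeBit≡adjacent wellFormed a<b)))))
          (sym (graphOf-edgeBit wellFormed))

      length-withEdge : length withEdge ≡ length (trees reduced)
      length-withEdge = length-≡-by-bijection
        (unique-filterᵇ _ (trees-unique d)) (trees-unique reduced)
        removeLeaf attachLeaf removeLeaf-∈ attachLeaf-∈ attach-remove remove-attach

-- Counting tree realizations

weight : {n : ℕ} → DegSeq n → ℕ
weight d = product (λ i → (d i ∸ 1) !)

1≤weight : {n : ℕ} (d : DegSeq n) → 1 ≤ weight d
1≤weight {zero} d = ≤-refl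
1≤weight {suc n} d = *-mono-≤ (1≤n! (d zero ∸ 1)) (1≤weight (d ∘ suc))

#trees-two-vertices : (d : DegSeq 2) → TreeDegSeq 2 d → #trees d * weight d ≡ 1
#trees-two-vertices d d-tree =
  cong₂ _*_ (cong length (trans (trees≡treeRealizations d) (treeRealizations-cong d≗1)))
            (product-cong-≗ (λ v → cong (λ x → (x ∸ 1) !) (d≗1 v)))
  where
  d≗1 : ∀ v → d v ≡ 1
  d≗1 = two-vertex-leaves d d-tree

module LeafCount {m : ℕ} (d : DegSeq (suc (suc (suc m)))) (d-tree : TreeDegSeq _ d)
                 {ℓ : Fin (suc (suc (suc m)))} (dℓ : d ℓ ≡ 1) where

  private
    d-pos : ∀ v → 1 ≤ d v
    d-pos = proj₁ d-tree
    sum-d : TreeDegreeSum _ d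
    sum-d = proj₂ d-tree

  module _ (k : Fin (suc (suc m))) where
    open LeafSurgery ℓ k

    excess : ℕ
    excess = d (punchIn ℓ k) ∸ 1

    #withEdge : ℕ
    #withEdge = length (withEdge d)

    #withEdge≡#trees-reduced : #withEdge ≡ #trees (reduced d)
    #withEdge≡#trees-reduced = length-withEdge d sum-d d-pos dℓ

    #withEdge-leaf : d (punchIn ℓ k) ≡ 1 → #withEdge ≡ 0
    #withEdge-leaf dk = trans #withEdge≡#trees-reduced
      (isolated⇒no-trees (reduced d) (cong₂ _∸_ dk (cong 𝟙 (==-refl k))))

    reduced-tree : 2 ≤ d (punchIn ℓ k) → TreeDegSeq _ (reduced d)
    reduced-tree 2≤dk = reduced-pos , reduced-sum d sum-d d-pos dℓ
      where
      reduced-pos : ∀ a → 1 ≤ reduced d a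
      reduced-pos a with k == a in k=a
      ... | true = subst (λ b → 1 ≤ d (punchIn ℓ b) ∸ 1) (==⇒≡ k=a) (∸-monoˡ-≤ 1 2≤dk)
      ... | false = d-pos (punchIn ℓ a)

    weight-reduced : 2 ≤ d (punchIn ℓ k) → weight d ≡ excess * weight (reduced d)
    weight-reduced 2≤dk = begin
        weight d                               ≡⟨ product-remove {i = ℓ} (λ i → (d i ∸ 1) !) ⟩
        (d ℓ ∸ 1) ! * product F                ≡⟨ cong (λ x → (x ∸ 1) ! * product F) dℓ ⟩
        1 * product F                          ≡⟨ *-identityˡ (product F) ⟩
        product F                              ≡⟨ product-remove {i = k} F ⟩
        excess ! * Q                           ≡⟨ cong (_* Q) (factorial-step (∸-monoˡ-≤ 1 2≤dk)) ⟩
        excess * (excess ∸ 1) ! * Q            ≡⟨ *-assoc excess ((excess ∸ 1) !) Q ⟩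
        excess * ((excess ∸ 1) ! * Q)          ≡⟨ cong (excess *_) (sym weight-reduced-remove) ⟩
        excess * weight (reduced d)            ∎
      where
      open ≡-Reasoning
      F : Fin (suc (suc m)) → ℕ
      F a = (d (punchIn ℓ a) ∸ 1) !
      Q : ℕ
      Q = product (F ∘ punchIn k)
      factorial-step : ∀ {x} → 1 ≤ x → x ! ≡ x * (x ∸ 1) !
      factorial-step {suc x} _ = refl
      weight-reduced-remove : weight (reduced d) ≡ (excess ∸ 1) ! * Q
      weight-reduced-remove = trans (product-remove {i = k} (λ a → (reduced d a ∸ 1) !))
        (cong₂ _*_ (cong (λ b → (d (punchIn ℓ k) ∸ 𝟙 b ∸ 1) !) (==-refl k))
                   (product-cong-≗ (λ b → cong (λ x → (d (punchIn ℓ (punchIn k b)) ∸ 𝟙 x ∸ 1) !) (==-≢ (punchIn≢ k b)))))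

  #trees-by-neighbour : #trees d ≡ ∑[ k < suc (suc m) ] #withEdge k
  #trees-by-neighbour = length-by-classes (λ G k → adjacent G ℓ (punchIn ℓ k)) (trees d)
    (λ G∈ → leaf-has-one-neighbour (∈-trees⁻ d G∈) dℓ)

  ∑-excess-neighbours : ∑[ k < suc (suc m) ] excess k ≡ suc m
  ∑-excess-neighbours = trans (sym (cong (λ x → x ∸ 1 + ∑[ k < suc (suc m) ] excess k) dℓ))
    (trans (sym (sum-remove {i = ℓ} (λ i → d i ∸ 1))) (∑-excess d d-tree))

#trees*weight : (m : ℕ) (d : DegSeq (suc (suc m))) → TreeDegSeq _ d → #trees d * weight d ≡ m !
#trees*weight zero d d-tree = #trees-two-vertices d d-tree
#trees*weight (suc m) d d-tree = begin
    #trees d * weight d                            ≡⟨ cong (_* weight d) #trees-by-neighbour ⟩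
    (∑[ k < suc (suc m) ] #withEdge k) * weight d   ≡⟨ *-distribʳ-sum (weight d) #withEdge ⟩
    ∑[ k < suc (suc m) ] (#withEdge k * weight d)   ≡⟨ sum-cong-≗ per-neighbour ⟩
    ∑[ k < suc (suc m) ] (excess k * m !)          ≡⟨ sym (*-distribʳ-sum (m !) excess) ⟩
    (∑[ k < suc (suc m) ] excess k) * m !          ≡⟨ cong (_* m !) ∑-excess-neighbours ⟩
    suc m * m !                                    ∎
  where
  open ≡-Reasoning
  ℓ : Fin (suc (suc (suc m)))
  ℓ = proj₁ (leaf-exists d d-tree)
  dℓ : d ℓ ≡ 1
  dℓ = proj₂ (leaf-exists d d-tree)
  open LeafCount d d-tree dℓ
  per-neighbour : ∀ k → #withEdge k * weight d ≡ excess k * m !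
  per-neighbour k with d (punchIn ℓ k) ℕ.≟ 1
  ... | yes dk = trans (cong (_* weight d) (#withEdge-leaf k dk)) (cong (λ x → (x ∸ 1) * m !) (sym dk))
  ... | no dk≢1 = begin
      #withEdge k * weight d                          ≡⟨ cong₂ _*_ (#withEdge≡#trees-reduced k) (weight-reduced k 2≤dk) ⟩
      #trees red * (excess k * weight red)           ≡⟨ *-left-swap (#trees red) (excess k) (weight red) ⟩
      excess k * (#trees red * weight red)           ≡⟨ cong (excess k *_) (#trees*weight m red (reduced-tree k 2≤dk)) ⟩
      excess k * m !                                 ∎
    where
    2≤dk : 2 ≤ d (punchIn ℓ k)
    2≤dk = ≢1⇒2≤ (proj₁ d-tree (punchIn ℓ k)) dk≢1
    red : DegSeq (suc (suc m))
    red = LeafSurgery.reduced ℓ k d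

-- Trees containing a given edge

#containing : {n : ℕ} → DegSeq n → Fin n → Fin n → ℕ
#containing d i j = ∑ˡ (λ G → 𝟙 (adjacent G i j)) (trees d)

#containing-sym : {n : ℕ} (d : DegSeq n) (i j : Fin n) → #containing d i j ≡ #containing d j i
#containing-sym d i j = ∑ˡ-cong (trees d) (λ G _ → cong 𝟙 (adjacent-sym G i j))

module _ {m : ℕ} (d : DegSeq (suc (suc (suc m)))) (d-tree : TreeDegSeq _ d) where

  #containing-leaf-punchIn : {ℓ : Fin (suc (suc (suc m)))} → d ℓ ≡ 1 → ∀ k →
    suc m * #containing d ℓ (punchIn ℓ k) ≡ #trees d * (d ℓ ∸ 1 + (d (punchIn ℓ k) ∸ 1))
  #containing-leaf-punchIn {ℓ} dℓ k = begin
      suc m * #containing d ℓ (punchIn ℓ k)   ≡⟨ cong (suc m *_) (sym (length-filterᵇ (ℓ-adjacent-to k) (trees d))) ⟩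
      suc m * #withEdge k                      ≡⟨ ratio (d (punchIn ℓ k) ℕ.≟ 1) ⟩
      excess k * #trees d                     ≡⟨ *-comm (excess k) (#trees d) ⟩
      #trees d * excess k                     ≡⟨ cong (λ x → #trees d * (x ∸ 1 + excess k)) (sym dℓ) ⟩
      #trees d * (d ℓ ∸ 1 + excess k)         ∎
    where
    open ≡-Reasoning
    open LeafCount d d-tree dℓ
    ℓ-adjacent-to : Fin (suc (suc m)) → Graph (suc (suc (suc m))) → Bool
    ℓ-adjacent-to k G = adjacent G ℓ (punchIn ℓ k)
    ratio : Dec (d (punchIn ℓ k) ≡ 1) → suc m * #withEdge k ≡ excess k * #trees d
    ratio (yes dk) = trans (cong (suc m *_) (#withEdge-leaf k dk))
      (trans (*-zeroʳ (suc m)) (cong (λ x → (x ∸ 1) * #trees d) (sym dk)))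
    ratio (no dk≢1) = *-cancelʳ-≡ _ _ (weight red) {{>-nonZero (1≤weight red)}} (begin
        suc m * #withEdge k * weight red         ≡⟨ *-assoc (suc m) (#withEdge k) (weight red) ⟩
        suc m * (#withEdge k * weight red)       ≡⟨ cong (λ x → suc m * (x * weight red)) (#withEdge≡#trees-reduced k) ⟩
        suc m * (#trees red * weight red)       ≡⟨ cong (suc m *_) (#trees*weight m red (reduced-tree k 2≤dk)) ⟩
        suc m ! ≡⟨ sym (#trees*weight (suc m) d d-tree) ⟩
        #trees d * weight d                     ≡⟨ cong (#trees d *_) (weight-reduced k 2≤dk) ⟩
        #trees d * (excess k * weight red)      ≡⟨ *-left-swap (#trees d) (excess k) (weight red) ⟩
        excess k * (#trees d * weight red)      ≡⟨ sym (*-assoc (excess k) (#trees d) (weight red)) ⟩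
        excess k * #trees d * weight red        ∎)
      where
      2≤dk : 2 ≤ d (punchIn ℓ k)
      2≤dk = ≢1⇒2≤ (proj₁ d-tree (punchIn ℓ k)) dk≢1
      red : DegSeq (suc (suc m))
      red = LeafSurgery.reduced ℓ k d

  #containing-leaf : {i j : Fin (suc (suc (suc m)))} → d i ≡ 1 → i ≢ j →
    suc m * #containing d i j ≡ #trees d * (d i ∸ 1 + (d j ∸ 1))
  #containing-leaf {i} {j} di i≢j with punchIn-view i j
  ... | inj₁ refl = ⊥-elim (i≢j refl)
  ... | inj₂ (k , refl) = #containing-leaf-punchIn di k

  #containing-edge : {i j : Fin (suc (suc (suc m)))} → d i ≡ 1 ⊎ d j ≡ 1 → i ≢ j →
    suc m * #containing d i j ≡ #trees d * (d i ∸ 1 + (d j ∸ 1))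
  #containing-edge (inj₁ di) i≢j = #containing-leaf di i≢j
  #containing-edge {i} {j} (inj₂ dj) i≢j = begin
      suc m * #containing d i j          ≡⟨ cong (suc m *_) (#containing-sym d i j) ⟩
      suc m * #containing d j i          ≡⟨ #containing-leaf dj (i≢j ∘ sym) ⟩
      #trees d * (d j ∸ 1 + (d i ∸ 1))   ≡⟨ cong (#trees d *_) (+-comm (d j ∸ 1) (d i ∸ 1)) ⟩
      #trees d * (d i ∸ 1 + (d j ∸ 1))   ∎
    where open ≡-Reasoning

-- Common edges

module _ {n : ℕ} where

  commonEdges-adjacent : {g h : Graph n} → g ∈ allGraphs n → h ∈ allGraphs n →
    commonEdges g h ≡ ∑[ i < n ] ∑[ j < n ] (𝟙 (i <ᵇ j) * (𝟙 (adjacent g i j) * 𝟙 (adjacent h i j)))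
  commonEdges-adjacent {g} {h} g∈ h∈ = begin
      commonEdges g h
        ≡⟨ cong₂ (λ g h → length (filterᵇ id (zipWith _∧_ (bits g) (bits h)))) (graphOf-edgeBit g∈) (graphOf-edgeBit h∈) ⟩
      length (filterᵇ id (zipWith _∧_ (map (uncurry (edgeBit g)) (pairs n)) (map (uncurry (edgeBit h)) (pairs n))))
        ≡⟨ cong (length ∘ filterᵇ id) (zipWith-∧-map (uncurry (edgeBit g)) (uncurry (edgeBit h)) (pairs n)) ⟩
      length (filterᵇ id (map both (pairs n)))
        ≡⟨ trans (length-filterᵇ id (map both (pairs n))) (∑ˡ-map 𝟙 both (pairs n)) ⟩
      ∑ˡ (𝟙 ∘ both) (pairs n)
        ≡⟨ ∑-pairs (𝟙 ∘ both) ⟩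
      ∑[ i < n ] ∑[ j < n ] (𝟙 (i <ᵇ j) * 𝟙 (edgeBit g i j ∧ edgeBit h i j))
        ≡⟨ sum-cong-≗ (λ i → sum-cong-≗ (λ j → on-pairs i j)) ⟩
      ∑[ i < n ] ∑[ j < n ] (𝟙 (i <ᵇ j) * (𝟙 (adjacent g i j) * 𝟙 (adjacent h i j))) ∎
    where
    open ≡-Reasoning
    both : Fin n × Fin n → Bool
    both (i , j) = edgeBit g i j ∧ edgeBit h i j
    on-pairs : ∀ i j → 𝟙 (i <ᵇ j) * 𝟙 (edgeBit g i j ∧ edgeBit h i j) ≡ 𝟙 (i <ᵇ j) * (𝟙 (adjacent g i j) * 𝟙 (adjacent h i j))
    on-pairs i j with i <ᵇ j in i<j
    ... | false = refl
    ... | true = cong (1 *_) (trans (𝟙-∧ (edgeBit g i j) (edgeBit h i j))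
                   (cong₂ (λ x y → 𝟙 x * 𝟙 y) (edgeBit≡adjacent g∈ i<j) (edgeBit≡adjacent h∈ i<j)))

  totalCommon-expansion : (d f : DegSeq n) →
    totalCommon d f ≡ ∑[ i < n ] ∑[ j < n ] (𝟙 (i <ᵇ j) * (#containing d i j * #containing f i j))
  totalCommon-expansion d f = begin
      totalCommon d f
        ≡⟨ cong₂ (λ D F → ℕL.sum (concatMap (λ t₁ → map (commonEdges t₁) F) D))
                 (sym (trees≡treeRealizations d)) (sym (trees≡treeRealizations f)) ⟩
      ℕL.sum (concatMap (λ t₁ → map (commonEdges t₁) TF) TD)
        ≡⟨ cong ℕL.sum (sym (List.map-id (concatMap (λ t₁ → map (commonEdges t₁) TF) TD))) ⟩
      ∑ˡ id (concatMap (λ t₁ → map (commonEdges t₁) TF) TD)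
        ≡⟨ ∑ˡ-concatMap id (λ t₁ → map (commonEdges t₁) TF) TD ⟩
      ∑ˡ (λ t₁ → ∑ˡ id (map (commonEdges t₁) TF)) TD
        ≡⟨ ∑ˡ-cong TD (λ t₁ t₁∈ → trans (∑ˡ-map id (commonEdges t₁) TF)
                                   (∑ˡ-cong TF (λ t₂ t₂∈ → commonEdges-adjacent (wf d t₁∈) (wf f t₂∈)))) ⟩
      ∑ˡ (λ t₁ → ∑ˡ (λ t₂ → ∑[ i < n ] ∑[ j < n ] F t₁ t₂ i j) TF) TD
        ≡⟨ ∑ˡ-cong TD (λ t₁ _ → trans (∑ˡ-∑ (λ t₂ i → ∑[ j < n ] F t₁ t₂ i j) TF)
                                       (sum-cong-≗ (λ i → ∑ˡ-∑ (λ t₂ j → F t₁ t₂ i j) TF))) ⟩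
      ∑ˡ (λ t₁ → ∑[ i < n ] ∑[ j < n ] ∑ˡ (λ t₂ → F t₁ t₂ i j) TF) TD
        ≡⟨ trans (∑ˡ-∑ (λ t₁ i → ∑[ j < n ] ∑ˡ (λ t₂ → F t₁ t₂ i j) TF) TD)
                 (sum-cong-≗ (λ i → ∑ˡ-∑ (λ t₁ j → ∑ˡ (λ t₂ → F t₁ t₂ i j) TF) TD)) ⟩
      ∑[ i < n ] ∑[ j < n ] ∑ˡ (λ t₁ → ∑ˡ (λ t₂ → F t₁ t₂ i j) TF) TD
        ≡⟨ sum-cong-≗ (λ i → sum-cong-≗ (λ j → factor i j)) ⟩
      ∑[ i < n ] ∑[ j < n ] (𝟙 (i <ᵇ j) * (#containing d i j * #containing f i j)) ∎
    where
    open ≡-Reasoning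
    TD TF : List (Graph n)
    TD = trees d
    TF = trees f
    wf : (e : DegSeq n) {G : Graph n} → G ∈ trees e → G ∈ allGraphs n
    wf e {G} G∈ = proj₁ (∈-filterᵇ⁻ _ {xs = allGraphs n} (subst (G ∈_) (trees≡treeRealizations e) G∈))
    F : Graph n → Graph n → Fin n → Fin n → ℕ
    F t₁ t₂ i j = 𝟙 (i <ᵇ j) * (𝟙 (adjacent t₁ i j) * 𝟙 (adjacent t₂ i j))
    factor : ∀ i j → ∑ˡ (λ t₁ → ∑ˡ (λ t₂ → F t₁ t₂ i j) TF) TD ≡ 𝟙 (i <ᵇ j) * (#containing d i j * #containing f i j)
    factor i j = begin
        ∑ˡ (λ t₁ → ∑ˡ (λ t₂ → F t₁ t₂ i j) TF) TD
          ≡⟨ ∑ˡ-cong TD (λ t₁ _ → trans (∑ˡ-cong TF (λ t₂ _ → sym (*-assoc (𝟙 (i <ᵇ j)) (𝟙 (adjacent t₁ i j)) _)))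
                                          (∑ˡ-*ˡ (𝟙 (i <ᵇ j) * 𝟙 (adjacent t₁ i j)) (λ t₂ → 𝟙 (adjacent t₂ i j)) TF)) ⟩
        ∑ˡ (λ t₁ → 𝟙 (i <ᵇ j) * 𝟙 (adjacent t₁ i j) * #containing f i j) TD
          ≡⟨ ∑ˡ-*ʳ (#containing f i j) (λ t₁ → 𝟙 (i <ᵇ j) * 𝟙 (adjacent t₁ i j)) TD ⟩
        ∑ˡ (λ t₁ → 𝟙 (i <ᵇ j) * 𝟙 (adjacent t₁ i j)) TD * #containing f i j
          ≡⟨ cong (_* #containing f i j) (∑ˡ-*ˡ (𝟙 (i <ᵇ j)) (λ t₁ → 𝟙 (adjacent t₁ i j)) TD) ⟩
        𝟙 (i <ᵇ j) * #containing d i j * #containing f i j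
          ≡⟨ *-assoc (𝟙 (i <ᵇ j)) (#containing d i j) (#containing f i j) ⟩
        𝟙 (i <ᵇ j) * (#containing d i j * #containing f i j) ∎

module _ {m : ℕ} (d f : DegSeq (suc (suc (suc m)))) (d-tree : TreeDegSeq _ d) (f-tree : TreeDegSeq _ f)
         (leaf-in-one : ∀ v → d v ≡ 1 ⊎ f v ≡ 1) where

  private
    a b : Fin (suc (suc (suc m))) → ℕ
    a i = d i ∸ 1
    b i = f i ∸ 1
    c : ℕ
    c = suc m
    vanish-left : ∀ {x x′} (y y′ : ℕ) → x ≡ 0 → x′ ≡ 0 → x * y ≡ x′ * y′
    vanish-left y y′ refl refl = refl
    vanish-right : ∀ (x x′ : ℕ) {y y′} → y ≡ 0 → y′ ≡ 0 → x * y ≡ x′ * y′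
    vanish-right x x′ refl refl = trans (*-zeroʳ x) (sym (*-zeroʳ x′))

  disjoint-excess : ∀ i → a i * b i ≡ 0
  disjoint-excess i with leaf-in-one i
  ... | inj₁ di = cong (λ x → (x ∸ 1) * b i) di
  ... | inj₂ fi = trans (cong (λ x → a i * (x ∸ 1)) fi) (*-zeroʳ (a i))

  scaled-pair : ∀ {i j} → i ≢ j →
    (c * #containing d i j) * (c * #containing f i j) ≡ (#trees d * (a i + a j)) * (#trees f * (b i + b j))
  scaled-pair {i} {j} i≢j with leaf-in-one i | leaf-in-one j
  ... | inj₁ di | inj₂ fj = cong₂ _*_ (#containing-edge d d-tree (inj₁ di) i≢j) (#containing-edge f f-tree (inj₂ fj) i≢j)
  ... | inj₂ fi | inj₁ dj = cong₂ _*_ (#containing-edge d d-tree (inj₂ dj) i≢j) (#containing-edge f f-tree (inj₁ fi) i≢j)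
  ... | inj₁ di | inj₁ dj = vanish-left (c * #containing f i j) (#trees f * (b i + b j))
      (trans (#containing-edge d d-tree (inj₁ di) i≢j) no-excess) no-excess
    where
    no-excess : #trees d * (a i + a j) ≡ 0
    no-excess = trans (cong₂ (λ x y → #trees d * (x ∸ 1 + (y ∸ 1))) di dj) (*-zeroʳ (#trees d))
  ... | inj₂ fi | inj₂ fj = vanish-right (c * #containing d i j) (#trees d * (a i + a j))
      (trans (#containing-edge f f-tree (inj₁ fi) i≢j) no-excess) no-excess
    where
    no-excess : #trees f * (b i + b j) ≡ 0
    no-excess = trans (cong₂ (λ x y → #trees f * (x ∸ 1 + (y ∸ 1))) fi fj) (*-zeroʳ (#trees f))

  totalCommon-many-vertices : totalCommon d f ≡ #trees d * #trees f
  totalCommon-many-vertices = *-cancelˡ-≡ _ _ (c * c) (begin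
      c * c * totalCommon d f
        ≡⟨ cong (c * c *_) (totalCommon-expansion d f) ⟩
      c * c * ∑[ i < n ] ∑[ j < n ] (𝟙 (i <ᵇ j) * (#containing d i j * #containing f i j))
        ≡⟨ trans (*-distribˡ-sum (c * c) (sum ∘ N)) (sum-cong-≗ (λ i → *-distribˡ-sum (c * c) (N i))) ⟩
      ∑[ i < n ] ∑[ j < n ] (c * c * (𝟙 (i <ᵇ j) * (#containing d i j * #containing f i j)))
        ≡⟨ sum-cong-≗ (λ i → sum-cong-≗ (λ j → per-pair i j)) ⟩
      ∑[ i < n ] ∑[ j < n ] (#trees d * #trees f * (𝟙 (i <ᵇ j) * ((a i + a j) * (b i + b j))))
        ≡⟨ sym (trans (*-distribˡ-sum (#trees d * #trees f) (sum ∘ E))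
                      (sum-cong-≗ (λ i → *-distribˡ-sum (#trees d * #trees f) (E i)))) ⟩
      #trees d * #trees f * ∑[ i < n ] ∑[ j < n ] (𝟙 (i <ᵇ j) * ((a i + a j) * (b i + b j)))
        ≡⟨ cong (#trees d * #trees f *_) (∑-pairs-disjoint-supports a b disjoint-excess) ⟩
      #trees d * #trees f * (sum a * sum b)
        ≡⟨ cong (#trees d * #trees f *_) (cong₂ _*_ (∑-excess d d-tree) (∑-excess f f-tree)) ⟩
      #trees d * #trees f * (c * c)
        ≡⟨ *-comm (#trees d * #trees f) (c * c) ⟩
      c * c * (#trees d * #trees f) ∎)
    where
    open ≡-Reasoning
    n : ℕ
    n = suc (suc (suc m))
    N E : Fin n → Fin n → ℕ
    N i j = 𝟙 (i <ᵇ j) * (#containing d i j * #containing f i j)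
    E i j = 𝟙 (i <ᵇ j) * ((a i + a j) * (b i + b j))
    per-pair : ∀ i j → c * c * (𝟙 (i <ᵇ j) * (#containing d i j * #containing f i j))
                     ≡ #trees d * #trees f * (𝟙 (i <ᵇ j) * ((a i + a j) * (b i + b j)))
    per-pair i j with i <ᵇ j in i<j
    ... | false = trans (*-zeroʳ (c * c)) (sym (*-zeroʳ (#trees d * #trees f)))
    ... | true = begin
        c * c * (1 * (#containing d i j * #containing f i j))
          ≡⟨ cong (c * c *_) (*-identityˡ _) ⟩
        c * c * (#containing d i j * #containing f i j)
          ≡⟨ *-interchange c c (#containing d i j) (#containing f i j) ⟩
        c * #containing d i j * (c * #containing f i j)
          ≡⟨ scaled-pair (<ᵇ⇒≢ i<j) ⟩
        #trees d * (a i + a j) * (#trees f * (b i + b j))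
          ≡⟨ *-interchange (#trees d) (a i + a j) (#trees f) (b i + b j) ⟩
        #trees d * #trees f * ((a i + a j) * (b i + b j))
          ≡⟨ cong (#trees d * #trees f *_) (sym (*-identityˡ _)) ⟩
        #trees d * #trees f * (1 * ((a i + a j) * (b i + b j))) ∎

totalCommon-two-vertices : (d f : DegSeq 2) → TreeDegSeq 2 d → TreeDegSeq 2 f → totalCommon d f ≡ #trees d * #trees f
totalCommon-two-vertices d f d-tree f-tree =
  trans (cong₂ (λ D F → ℕL.sum (concatMap (λ t₁ → map (commonEdges t₁) F) D))
               (treeRealizations-cong d≗1) (treeRealizations-cong f≗1))
        (sym (cong₂ (λ D F → length D * length F) (trans (trees≡treeRealizations d) (treeRealizations-cong d≗1))
                                                   (trans (trees≡treeRealizations f) (treeRealizations-cong f≗1))))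
  where
  d≗1 : ∀ v → d v ≡ 1
  d≗1 = two-vertex-leaves d d-tree
  f≗1 : ∀ v → f v ≡ 1
  f≗1 = two-vertex-leaves f f-tree

totalCommon≡#trees*#trees : (n : ℕ) (d f : DegSeq n) → TreeDegSeq n d → TreeDegSeq n f →
  (∀ i → d i ⊓ f i ≡ 1) → totalCommon d f ≡ #trees d * #trees f
totalCommon≡#trees*#trees zero d f (_ , ()) _ _
totalCommon≡#trees*#trees (suc zero) d f d-tree _ _ = ⊥-elim (no-one-vertex-tree d d-tree)
totalCommon≡#trees*#trees (suc (suc zero)) d f d-tree f-tree _ = totalCommon-two-vertices d f d-tree f-tree
totalCommon≡#trees*#trees (suc (suc (suc m))) d f d-tree f-tree min≡1 =
  totalCommon-many-vertices d f d-tree f-tree (⊓≡1⇒ ∘ min≡1)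

mainTheorem2 : (n : ℕ) (d f : DegSeq n) → TreeDegSeq n d → TreeDegSeq n f
    → ((i : Fin n) → d i ⊓ f i ≡ 1)
    → totalCommon d f ≡ length (treeRealizations d) * length (treeRealizations f)
mainTheorem2 n d f d-tree f-tree min≡1 =
  trans (totalCommon≡#trees*#trees n d f d-tree f-tree min≡1)
        (cong₂ _*_ (cong length (trees≡treeRealizations d)) (cong length (trees≡treeRealizations f)))
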